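{- If $\mathcal{P}(G)$ is the edge polytope of a simple graph $G$, then $f_0(\mathcal{P}(G))=e(G)$ and \[ f_1(\mathcal{P}(G))=\binom{e(G)}{2}-2c_4(G)+3k_4(G). \]
   Context: All graphs are finite, undirected, without loops, multiple edges or isolated vertices. For a graph $G$ on vertex set $[n]$, the edge polytope is $\mathcal{P}(G)=\mathrm{conv}\{e_i+e_j : \{i,j\}\in E(G)\}\subseteq\mathbb{R}^n$. $f_k(P)$ denotes the number of $k$-dimensional faces of a polytope $P$. $e(G)$ is the number of edges of $G$, $c_4(G)$ the number of subgraphs of $G$ isomorphic to the $4$-cycle $C_4$, and $k_4(G)$ the number of subgraphs of $G$ isomorphic to $K_4$. -}

module Defs where

open import Data.Bool using (Bool; true; false; _∧_; _∨_; if_then_else_)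
open import Data.Nat as ℕ using (ℕ; zero; suc)
open import Data.Fin using (Fin; toℕ; _≟_)
open import Data.Fin.Subset as Sub using (Subset; _⊆_; ∣_∣; Nonempty)
open import Data.List using (List; []; _∷_; [_]; length; concatMap; lookup; allFin; foldr; filter)
open import Data.List.Relation.Unary.Unique.Propositional using (Unique)
import Data.List.Membership.Propositional as LMem
open import Data.Product using (Σ; ∃; ∃-syntax; _×_; _,_)
open import Data.Rational as ℚ using (ℚ; 0ℚ; 1ℚ)
open import Relation.Binary.PropositionalEquality using (_≡_)
open import Relation.Nullary using (¬_; does)
open import Function.Bundles using (_⇔_)

record SimpleGraph (n : ℕ) : Set where
  field
    adj    : Fin n → Fin n → Bool
    sym    : ∀ i j → adj i j ≡ adj j i
    irrefl : ∀ i → adj i i ≡ false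
open SimpleGraph public

NoIsolated : ∀ {n} → SimpleGraph n → Set
NoIsolated G = ∀ i → ∃[ j ] (adj G i j ≡ true)

_<ᶠ_ : ∀ {n} → Fin n → Fin n → Bool
i <ᶠ j = toℕ i ℕ.<ᵇ toℕ j

edges : ∀ {n} → SimpleGraph n → List (Fin n × Fin n)
edges {n} G =
  concatMap (λ i → concatMap (λ j → if (i <ᶠ j) ∧ adj G i j then [ (i , j) ] else [])
                             (allFin n))
            (allFin n)

e : ∀ {n} → SimpleGraph n → ℕ
e G = length (edges G)

count : ∀ {A : Set} → (A → Bool) → List A → ℕ
count p xs = length (filter (λ x → Data.Bool.T? (p x)) xs)
  where import Data.Bool

quads : ∀ n → List (Fin n × Fin n × Fin n × Fin n)
quads n =
  concatMap (λ a → concatMap (λ b → concatMap (λ c → concatMap (λ d →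
    if (a <ᶠ b) ∧ (b <ᶠ c) ∧ (c <ᶠ d) then [ (a , b , c , d) ] else [])
    (allFin n)) (allFin n)) (allFin n)) (allFin n)

b2n : Bool → ℕ
b2n true = 1
b2n false = 0

sumℕ : List ℕ → ℕ
sumℕ = foldr ℕ._+_ 0

cyc : ∀ {n} → SimpleGraph n → Fin n → Fin n → Fin n → Fin n → Bool
cyc G w x y z = adj G w x ∧ adj G x y ∧ adj G y z ∧ adj G z w

-- c₄(G): number of subgraphs isomorphic to C₄.  A 4-set {a<b<c<d} supports
-- exactly three distinct 4-cycles: a-b-c-d, a-b-d-c, a-c-b-d.
c4 : ∀ {n} → SimpleGraph n → ℕ
c4 {n} G = sumℕ (Data.List.map (λ { (a , b , c , d) →
    b2n (cyc G a b c d) ℕ.+ b2n (cyc G a b d c) ℕ.+ b2n (cyc G a c b d) }) (quads n))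
  where import Data.List

k4 : ∀ {n} → SimpleGraph n → ℕ
k4 {n} G = count (λ { (a , b , c , d) →
    adj G a b ∧ adj G a c ∧ adj G a d ∧ adj G b c ∧ adj G b d ∧ adj G c d }) (quads n)

Pt : ℕ → Set
Pt n = Fin n → ℚ

sumℚ : ∀ {A : Set} → List A → (A → ℚ) → ℚ
sumℚ xs f = foldr (λ x acc → f x ℚ.+ acc) 0ℚ xs

dot : ∀ {n} → Pt n → Pt n → ℚ
dot {n} c x = sumℚ (allFin n) (λ k → c k ℚ.* x k)

eij : ∀ {n} → Fin n × Fin n → Pt n
eij (i , j) k = if does (k ≟ i) ∨ does (k ≟ j) then 1ℚ else 0ℚ

edgeGen : ∀ {n} (G : SimpleGraph n) → Fin (e G) → Pt n
edgeGen G k = eij (lookup (edges G) k)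

-- A nonempty face of P = conv{p_k} is determined by the set S of
-- generators it contains: S is (the generator set of) a face iff there is
-- a supporting hyperplane  c·x ≤ b  of P with  {k | c·p_k = b} = S.
IsFace : ∀ {m n} → (Fin m → Pt n) → Subset m → Set
IsFace {m} {n} p S =
  Nonempty S ×
  (∃[ c ] ∃[ b ] ((∀ k → dot c (p k) ℚ.≤ b) ×
                  (∀ k → (dot c (p k) ≡ b) ⇔ (k Sub.∈ S))))

AffIndep : ∀ {m n} → (Fin m → Pt n) → Subset m → Set
AffIndep {m} {n} p T =
  ∀ (λ' : Fin m → ℚ) →
    (∀ k → ¬ (k Sub.∈ T) → λ' k ≡ 0ℚ) →
    sumℚ (allFin m) λ' ≡ 0ℚ →
    (∀ i → sumℚ (allFin m) (λ k → λ' k ℚ.* p k i) ≡ 0ℚ) →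
    ∀ k → λ' k ≡ 0ℚ

AffDim : ∀ {m n} → (Fin m → Pt n) → Subset m → ℕ → Set
AffDim {m} p S d =
  (∃[ T ] (T ⊆ S × AffIndep p T × ∣ T ∣ ≡ suc d)) ×
  (∀ T → T ⊆ S → AffIndep p T → ∣ T ∣ ℕ.≤ suc d)

IsDFace : ∀ {m n} → (Fin m → Pt n) → ℕ → Subset m → Set
IsDFace p d S = IsFace p S × AffDim p S d

HasCount : ∀ {m} → (Subset m → Set) → ℕ → Set
HasCount {m} P N =
  ∃[ L ] (length L ≡ N × Unique L × (∀ S → (S LMem.∈ L) ⇔ P S))

FaceNumber : ∀ {m n} → (Fin m → Pt n) → ℕ → ℕ → Set
FaceNumber p d N = HasCount (IsDFace p d) N

-- The generators p k = e_i + e_j are vertices of P(G), each exposed by the weights 1 at i and j, and any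
-- three of them are affinely independent, so the vertices are the singletons and the edges of P(G) are the
-- pairs {k, l} that are faces. Such a pair fails to be a face exactly when the edges ab and cd are opposite
-- sides of a 4-cycle a-b-d-c of G: then p k + p l = p(ac) + p(bd), so every hyperplane supporting the
-- segment also contains p(ac). Otherwise the two edges share an end, or an end b of one edge is adjacent to
-- neither end of the other, and small integer weights on the vertices expose the pair. Hence
-- f₁ = C(e, 2) - (number of opposite pairs). An opposite pair is a perfect matching of a 4-set whose edges,
-- together with those of another matching, are present in G; on each 4-set, the number of such matchings
-- plus 3 [the 4-set spans K₄] is twice the number of its 4-cycles.
module Submission where

open import Data.Bool using (Bool; true; false; T; T?; _∧_; _∨_; if_then_else_)
open import Data.Bool.Properties using (T-∧; T-∨; T-≡)
open import Data.Empty using (⊥; ⊥-elim)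
open import Data.Fin using (Fin; zero; suc; _≟_; _<_)
open import Data.Fin.Subset as Subset using (Subset; ⁅_⁆; _∪_)
open import Data.List using (List; []; _∷_; map; concatMap; filter; allFin; length)
open import Data.List.Membership.Propositional using (_∈_)
open import Data.Nat using (ℕ; zero; suc)
open import Data.Product using (Σ; ∃-syntax; _×_; _,_; proj₁; proj₂)
open import Data.Sum using (_⊎_; inj₁; inj₂; [_,_])
open import Function using (_∘_; id)
open import Function.Bundles using (_⇔_; mk⇔; Equivalence)
open import Relation.Nullary using (¬_; Dec; yes; no; does)
open import Relation.Nullary.Decidable using (¬?; _×-dec_; _⊎-dec_; _→-dec_; toWitness)
open import Relation.Binary.PropositionalEquality using (_≡_; _≢_; refl; sym; trans; cong; cong₂; subst; subst₂)
open import Defs hiding (sym)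

module Lists where

  open import Data.Nat using (_+_; _*_; _≤_; z≤n; s≤s)
  open import Data.Nat.Properties using (≤-trans; ≤-antisym; m≤n⇒m≤1+n; +-suc; *-zeroʳ; *-distribˡ-+)
  open import Data.Nat.Solver using (module +-*-Solver)
  open import Data.List using ([_]; lookup)
  open import Data.List.Properties using (length-++)
  open import Data.List.Relation.Unary.All using (All; []; _∷_)
  open import Data.List.Relation.Unary.Any using (here; there)
  open import Data.List.Relation.Unary.Unique.Propositional using (Unique; []; _∷_)
  open import Data.List.Relation.Unary.Unique.Propositional.Properties using (++⁺)
  open import Data.List.Membership.Propositional using (find; lose)
  open import Data.List.Membership.Propositional.Properties using (∈-concatMap⁺; ∈-concatMap⁻; ∈-lookup)
  open import Level using (0ℓ)
  open import Relation.Unary using (Pred; Decidable)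
  open import Relation.Binary.Definitions using (DecidableEquality)
  open Relation.Binary.PropositionalEquality.≡-Reasoning

  private variable
    A B : Set

  ∈-concatMap⁺′ : (f : A → List B) {xs : List A} {x : A} {y : B} → x ∈ xs → y ∈ f x → y ∈ concatMap f xs
  ∈-concatMap⁺′ f x∈ y∈ = ∈-concatMap⁺ f (lose x∈ y∈)

  ∈-concatMap⁻′ : (f : A → List B) (xs : List A) {y : B} → y ∈ concatMap f xs → ∃[ x ] (x ∈ xs × y ∈ f x)
  ∈-concatMap⁻′ f xs y∈ = find (∈-concatMap⁻ f {xs = xs} y∈)

  ∈-guarded⁻ : ∀ (b : Bool) {x y : A} → y ∈ (if b then [ x ] else []) → y ≡ x × T b
  ∈-guarded⁻ true (here refl) = refl , _

  ∈-guarded⁺ : ∀ {b} {x : A} → T b → x ∈ (if b then [ x ] else [])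
  ∈-guarded⁺ {b = true} _ = here refl

  guarded-Unique : ∀ (b : Bool) {x : A} → Unique (if b then [ x ] else [])
  guarded-Unique true = [] ∷ []
  guarded-Unique false = []

  ∉-All : ∀ {x : A} {xs} → All (λ z → ¬ x ≡ z) xs → ∀ {z} → z ∈ xs → x ≢ z
  ∉-All (x≢y ∷ _) (here refl) = x≢y
  ∉-All (_ ∷ x∉) (there z∈) = ∉-All x∉ z∈

  lookup-injective : ∀ {xs : List A} → Unique xs → ∀ {i j} → lookup xs i ≡ lookup xs j → i ≡ j
  lookup-injective {xs = x ∷ xs} _ {zero} {zero} _ = refl
  lookup-injective {xs = x ∷ xs} (x∉ ∷ _) {zero} {suc j} x≡ = ⊥-elim (∉-All x∉ (∈-lookup j) x≡)
  lookup-injective {xs = x ∷ xs} (x∉ ∷ _) {suc i} {zero} ≡x = ⊥-elim (∉-All x∉ (∈-lookup i) (sym ≡x))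
  lookup-injective {xs = x ∷ xs} (_ ∷ xs!) {suc i} {suc j} eq = cong suc (lookup-injective xs! eq)

  -- The blocks f x are pairwise disjoint because the key of an element recovers its block.
  Unique-concatMap : (f : A → List B) (key : B → A) → (∀ x y → y ∈ f x → key y ≡ x) →
                     (∀ x → Unique (f x)) → {xs : List A} → Unique xs → Unique (concatMap f xs)
  Unique-concatMap f key key-f f! {[]} [] = []
  Unique-concatMap f key key-f f! {x ∷ xs} (x∉ ∷ xs!) = ++⁺ (f! x) (Unique-concatMap f key key-f f! xs!) disjoint
    where
    disjoint : ∀ {y} → ¬ (y ∈ f x × y ∈ concatMap f xs)
    disjoint {y} (y∈fx , y∈rest) with ∈-concatMap⁻′ f xs y∈rest
    ... | x′ , x′∈ , y∈fx′ = ∉-All x∉ x′∈ (trans (sym (key-f x y y∈fx)) (key-f x′ y y∈fx′))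

  Unique-map-injectiveOn : (f : A → B) {xs : List A} → Unique xs →
                           (∀ {x y} → x ∈ xs → y ∈ xs → f x ≡ f y → x ≡ y) → Unique (map f xs)
  Unique-map-injectiveOn f {[]} [] inj = []
  Unique-map-injectiveOn f {x ∷ xs} (x∉ ∷ xs!) inj =
    fx∉ x∉ id ∷ Unique-map-injectiveOn f xs! (λ x∈ y∈ → inj (there x∈) (there y∈))
    where
    fx∉ : ∀ {ys} → All (λ z → ¬ x ≡ z) ys → (∀ {y} → y ∈ ys → y ∈ xs) → All (λ z → ¬ f x ≡ z) (map f ys)
    fx∉ [] _ = []
    fx∉ (x≢y ∷ x∉) sub = (x≢y ∘ inj (here refl) (there (sub (here refl)))) ∷ fx∉ x∉ (sub ∘ there)

  module _ (_≟_ : DecidableEquality A) where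

    remove : A → List A → List A
    remove x [] = []
    remove x (y ∷ ys) with x ≟ y
    ... | yes _ = remove x ys
    ... | no _ = y ∷ remove x ys

    ∈-remove : ∀ {x y} ys → y ∈ ys → x ≢ y → y ∈ remove x ys
    ∈-remove {x} (z ∷ ys) (here refl) x≢y with x ≟ z
    ... | yes x≡y = ⊥-elim (x≢y x≡y)
    ... | no _ = here refl
    ∈-remove {x} (z ∷ ys) (there y∈) x≢y with x ≟ z
    ... | yes _ = ∈-remove ys y∈ x≢y
    ... | no _ = there (∈-remove ys y∈ x≢y)

    length-remove-≤ : ∀ x ys → length (remove x ys) ≤ length ys
    length-remove-≤ x [] = z≤n
    length-remove-≤ x (y ∷ ys) with x ≟ y
    ... | yes _ = m≤n⇒m≤1+n (length-remove-≤ x ys)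
    ... | no _ = s≤s (length-remove-≤ x ys)

    length-remove-< : ∀ {x} ys → x ∈ ys → suc (length (remove x ys)) ≤ length ys
    length-remove-< {x} (y ∷ ys) (here refl) with x ≟ y
    ... | yes _ = s≤s (length-remove-≤ x ys)
    ... | no x≢x = ⊥-elim (x≢x refl)
    length-remove-< {x} (y ∷ ys) (there x∈) with x ≟ y
    ... | yes _ = m≤n⇒m≤1+n (length-remove-< ys x∈)
    ... | no _ = s≤s (length-remove-< ys x∈)

    Unique-⊆⇒length-≤ : ∀ {xs ys : List A} → Unique xs → (∀ {v} → v ∈ xs → v ∈ ys) → length xs ≤ length ys
    Unique-⊆⇒length-≤ {[]} _ _ = z≤n
    Unique-⊆⇒length-≤ {x ∷ xs} {ys} (x∉ ∷ xs!) sub =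
      ≤-trans (s≤s (Unique-⊆⇒length-≤ xs! sub′)) (length-remove-< ys (sub (here refl)))
      where
      sub′ : ∀ {v} → v ∈ xs → v ∈ remove x ys
      sub′ v∈ = ∈-remove ys (sub (there v∈)) (∉-All x∉ v∈)

    Unique-⇔⇒length-≡ : ∀ {xs ys : List A} → Unique xs → Unique ys →
                        (∀ {v} → v ∈ xs → v ∈ ys) → (∀ {v} → v ∈ ys → v ∈ xs) → length xs ≡ length ys
    Unique-⇔⇒length-≡ xs! ys! xs⊆ys ys⊆xs = ≤-antisym (Unique-⊆⇒length-≤ xs! xs⊆ys) (Unique-⊆⇒length-≤ ys! ys⊆xs)

  module _ {P : Pred A 0ℓ} (P? : Decidable P) where

    length-filter-+-filter-¬ : ∀ xs → length (filter P? xs) + length (filter (λ x → ¬? (P? x)) xs) ≡ length xs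
    length-filter-+-filter-¬ [] = refl
    length-filter-+-filter-¬ (x ∷ xs) with P? x
    ... | yes _ = cong suc (length-filter-+-filter-¬ xs)
    ... | no _ = trans (+-suc _ _) (cong suc (length-filter-+-filter-¬ xs))

  length-concatMap : (f : A → List B) (xs : List A) → length (concatMap f xs) ≡ sumℕ (map (length ∘ f) xs)
  length-concatMap f [] = refl
  length-concatMap f (x ∷ xs) = trans (length-++ (f x)) (cong (length (f x) +_) (length-concatMap f xs))

  length-filter-T≡sum : (p : A → Bool) (xs : List A) → length (filter (T? ∘ p) xs) ≡ sumℕ (map (b2n ∘ p) xs)
  length-filter-T≡sum p [] = refl
  length-filter-T≡sum p (x ∷ xs) with p x
  ... | true = cong suc (length-filter-T≡sum p xs)
  ... | false = length-filter-T≡sum p xs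

  sumℕ-linear : ∀ (α β : ℕ) (f g h : A → ℕ) xs → (∀ x → f x + α * g x ≡ β * h x) →
                sumℕ (map f xs) + α * sumℕ (map g xs) ≡ β * sumℕ (map h xs)
  sumℕ-linear α β f g h [] _ = trans (cong (0 +_) (*-zeroʳ α)) (sym (*-zeroʳ β))
  sumℕ-linear α β f g h (x ∷ xs) pointwise = begin
    (f x + F) + α * (g x + G)        ≡⟨ regroup α (f x) (g x) F G ⟩
    (f x + α * g x) + (F + α * G)    ≡⟨ cong₂ _+_ (pointwise x) (sumℕ-linear α β f g h xs pointwise) ⟩
    β * h x + β * sumℕ (map h xs)    ≡⟨ sym (*-distribˡ-+ β (h x) _) ⟩
    β * (h x + sumℕ (map h xs))      ∎
    where
    F G : ℕ
    F = sumℕ (map f xs)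
    G = sumℕ (map g xs)
    regroup : ∀ k a b c d → (a + c) + k * (b + d) ≡ (a + k * b) + (c + k * d)
    regroup = solve 5 (λ k a b c d → (a :+ c) :+ k :* (b :+ d) := (a :+ k :* b) :+ (c :+ k :* d)) refl
      where open +-*-Solver

module Booleans where

  true≢false : true ≢ false
  true≢false ()

  T⇒≡true : ∀ {x} → T x → x ≡ true
  T⇒≡true = Equivalence.to T-≡

  ¬T⇒≡false : ∀ {x} → ¬ T x → x ≡ false
  ¬T⇒≡false {false} _ = refl
  ¬T⇒≡false {true} ¬T = ⊥-elim (¬T _)

  ∧-≡false : ∀ x {y} → x ∧ y ≡ false → x ≡ false ⊎ y ≡ false
  ∧-≡false false _ = inj₁ refl
  ∧-≡false true y≡false = inj₂ y≡false

  ∨-≡false : ∀ x {y} → x ∨ y ≡ false → x ≡ false × y ≡ false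
  ∨-≡false false y≡false = refl , y≡false

  ∀-Bool? : ∀ {P : Bool → Set} → (∀ b → Dec (P b)) → Dec (∀ b → P b)
  ∀-Bool? P? with P? false | P? true
  ... | yes p-false | yes p-true = yes λ { false → p-false ; true → p-true }
  ... | no ¬p-false | _ = no λ p → ¬p-false (p false)
  ... | yes _ | no ¬p-true = no λ p → ¬p-true (p true)

module FinOrder where

  open import Data.Fin using (toℕ)
  open import Data.Fin.Properties using (<-irrefl; <-asym; ≤∧≢⇒<)
  open import Data.Nat.Properties using (<ᵇ⇒<; <⇒<ᵇ; ≮⇒≥)
  open Booleans

  <ᶠ⇒< : ∀ {n} {x y : Fin n} → T (x <ᶠ y) → x < y
  <ᶠ⇒< {x = x} {y} = <ᵇ⇒< (toℕ x) (toℕ y)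

  <⇒<ᶠ : ∀ {n} {x y : Fin n} → x < y → T (x <ᶠ y)
  <⇒<ᶠ = <⇒<ᵇ

  <ᶠ⇒≢ : ∀ {n} {x y : Fin n} → T (x <ᶠ y) → x ≢ y
  <ᶠ⇒≢ {x = x} x<x refl = <-irrefl refl (<ᶠ⇒< {x = x} {x} x<x)

  <ᶠ-≡true⇒< : ∀ {n} {x y : Fin n} → (x <ᶠ y) ≡ true → x < y
  <ᶠ-≡true⇒< x<y = <ᶠ⇒< (Equivalence.from T-≡ x<y)

  <ᶠ-≡false⇒≮ : ∀ {n} {x y : Fin n} → (x <ᶠ y) ≡ false → ¬ x < y
  <ᶠ-≡false⇒≮ x≮y x<y = subst T x≮y (<⇒<ᶠ x<y)

  <⇒<ᶠ-≡true : ∀ {n} {x y : Fin n} → x < y → (x <ᶠ y) ≡ true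
  <⇒<ᶠ-≡true = T⇒≡true ∘ <⇒<ᶠ

  <⇒>ᶠ-≡false : ∀ {n} {x y : Fin n} → x < y → (y <ᶠ x) ≡ false
  <⇒>ᶠ-≡false x<y = ¬T⇒≡false (λ y<x → <-asym x<y (<ᶠ⇒< y<x))

  ≮∧≢⇒> : ∀ {n} {x y : Fin n} → ¬ x < y → x ≢ y → y < x
  ≮∧≢⇒> x≮y x≢y = ≤∧≢⇒< (≮⇒≥ x≮y) (x≢y ∘ sym)

module RationalOrder where

  open import Data.Rational using (ℚ; _+_; _≤_)
  open import Data.Rational.Properties using (_≤?_; ≤-antisym; ≰⇒>; <-irrefl; +-mono-<-≤)

  +≡B+B⇒≡B : ∀ {a c B : ℚ} → a ≤ B → c ≤ B → a + c ≡ B + B → a ≡ B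
  +≡B+B⇒≡B {a} {c} {B} a≤B c≤B a+c≡ with B ≤? a
  ... | yes B≤a = ≤-antisym a≤B B≤a
  ... | no B≰a = ⊥-elim (<-irrefl a+c≡ (+-mono-<-≤ (≰⇒> B≰a) c≤B))

module Subsets where

  open import Data.Fin.Subset using (∣_∣; Nonempty; inside; outside)
  open import Data.Fin.Subset.Properties using (x∈⁅x⁆; x∈⁅y⁆⇒x≡y; x∈p∪q⁺; x∈p∪q⁻; ∪-identityˡ; ∣⁅x⁆∣≡1)
  open import Data.Vec using (_∷_; here; there)

  ∈-⁅⁆ : ∀ {m} {k x : Fin m} → x Subset.∈ ⁅ k ⁆ → x ≡ k
  ∈-⁅⁆ {k = k} = x∈⁅y⁆⇒x≡y k

  ⁅⁆-injective : ∀ {m} {k l : Fin m} → ⁅ k ⁆ ≡ ⁅ l ⁆ → k ≡ l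
  ⁅⁆-injective {k = k} eq = ∈-⁅⁆ (subst (k Subset.∈_) eq (x∈⁅x⁆ k))

  ∈-⁅⁆∪⁅⁆ : ∀ {m} {k l x : Fin m} → x Subset.∈ ⁅ k ⁆ ∪ ⁅ l ⁆ ⇔ (x ≡ k ⊎ x ≡ l)
  ∈-⁅⁆∪⁅⁆ {k = k} {l} = mk⇔ to from
    where
    to : ∀ {x} → x Subset.∈ ⁅ k ⁆ ∪ ⁅ l ⁆ → x ≡ k ⊎ x ≡ l
    to x∈ with x∈p∪q⁻ ⁅ k ⁆ ⁅ l ⁆ x∈
    ... | inj₁ x∈k = inj₁ (∈-⁅⁆ x∈k)
    ... | inj₂ x∈l = inj₂ (∈-⁅⁆ x∈l)
    from : ∀ {x} → x ≡ k ⊎ x ≡ l → x Subset.∈ ⁅ k ⁆ ∪ ⁅ l ⁆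
    from (inj₁ refl) = x∈p∪q⁺ (inj₁ (x∈⁅x⁆ k))
    from (inj₂ refl) = x∈p∪q⁺ {p = ⁅ k ⁆} (inj₂ (x∈⁅x⁆ l))

  ∈-⁅⁆∪⁅⁆∪⁅⁆ : ∀ {m} {k l o x : Fin m} → x Subset.∈ ⁅ k ⁆ ∪ (⁅ l ⁆ ∪ ⁅ o ⁆) ⇔ (x ≡ k ⊎ x ≡ l ⊎ x ≡ o)
  ∈-⁅⁆∪⁅⁆∪⁅⁆ {k = k} {l} {o} = mk⇔ to from
    where
    to : ∀ {x} → x Subset.∈ ⁅ k ⁆ ∪ (⁅ l ⁆ ∪ ⁅ o ⁆) → x ≡ k ⊎ x ≡ l ⊎ x ≡ o
    to x∈ with x∈p∪q⁻ ⁅ k ⁆ _ x∈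
    ... | inj₁ x∈k = inj₁ (∈-⁅⁆ x∈k)
    ... | inj₂ x∈lo = inj₂ (Equivalence.to ∈-⁅⁆∪⁅⁆ x∈lo)
    from : ∀ {x} → x ≡ k ⊎ x ≡ l ⊎ x ≡ o → x Subset.∈ ⁅ k ⁆ ∪ (⁅ l ⁆ ∪ ⁅ o ⁆)
    from (inj₁ refl) = x∈p∪q⁺ (inj₁ (x∈⁅x⁆ k))
    from (inj₂ x≡) = x∈p∪q⁺ {p = ⁅ k ⁆} (inj₂ (Equivalence.from ∈-⁅⁆∪⁅⁆ x≡))

  ⁅⁆∪⁅⁆⊆ : ∀ {m} {k l : Fin m} {S : Subset m} → k Subset.∈ S → l Subset.∈ S → ⁅ k ⁆ ∪ ⁅ l ⁆ Subset.⊆ S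
  ⁅⁆∪⁅⁆⊆ k∈S l∈S x∈ with Equivalence.to ∈-⁅⁆∪⁅⁆ x∈
  ... | inj₁ refl = k∈S
  ... | inj₂ refl = l∈S

  ∣⁅x⁆∪p∣ : ∀ {m} (x : Fin m) (p : Subset m) → ¬ x Subset.∈ p → ∣ ⁅ x ⁆ ∪ p ∣ ≡ suc ∣ p ∣
  ∣⁅x⁆∪p∣ zero (outside ∷ p) _ = cong suc (cong ∣_∣ (∪-identityˡ p))
  ∣⁅x⁆∪p∣ zero (inside ∷ p) x∉ = ⊥-elim (x∉ here)
  ∣⁅x⁆∪p∣ (suc x) (outside ∷ p) x∉ = ∣⁅x⁆∪p∣ x p (x∉ ∘ there)
  ∣⁅x⁆∪p∣ (suc x) (inside ∷ p) x∉ = cong suc (∣⁅x⁆∪p∣ x p (x∉ ∘ there))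

  ∣⁅x⁆∪⁅y⁆∣ : ∀ {m} {x y : Fin m} → x ≢ y → ∣ ⁅ x ⁆ ∪ ⁅ y ⁆ ∣ ≡ 2
  ∣⁅x⁆∪⁅y⁆∣ {x = x} {y} x≢y = trans (∣⁅x⁆∪p∣ x ⁅ y ⁆ (x≢y ∘ ∈-⁅⁆)) (cong suc (∣⁅x⁆∣≡1 y))

  ∣⁅x⁆∪⁅y⁆∪⁅z⁆∣ : ∀ {m} {x y z : Fin m} → x ≢ y → x ≢ z → y ≢ z → ∣ ⁅ x ⁆ ∪ (⁅ y ⁆ ∪ ⁅ z ⁆) ∣ ≡ 3
  ∣⁅x⁆∪⁅y⁆∪⁅z⁆∣ {x = x} x≢y x≢z y≢z =
    trans (∣⁅x⁆∪p∣ x _ λ x∈ → [ x≢y , x≢z ] (Equivalence.to ∈-⁅⁆∪⁅⁆ x∈)) (cong suc (∣⁅x⁆∪⁅y⁆∣ y≢z))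

  nonempty : ∀ {m} (p : Subset m) {c} → ∣ p ∣ ≡ suc c → Nonempty p
  nonempty (inside ∷ p) _ = zero , here
  nonempty (outside ∷ p) size with nonempty p size
  ... | x , x∈ = suc x , there x∈

module IncreasingPairs where

  open import Data.Nat using (_+_; z≤n; s≤s)
  open import Data.Nat.Combinatorics using (_C_; nC1≡n; nCk+nC[k+1]≡[n+1]C[k+1])
  open import Data.Fin.Properties using (suc-injective)
  open import Data.List using (_++_)
  open import Data.List.Properties using (length-map; length-tabulate; length-++)
  open import Data.List.Relation.Unary.Unique.Propositional using (Unique; [])
  open import Data.List.Relation.Unary.Unique.Propositional.Properties using (map⁺; allFin⁺; ++⁺)
  open import Data.List.Membership.Propositional.Properties using (∈-map⁺; ∈-map⁻; ∈-allFin; ∈-++⁺ˡ; ∈-++⁺ʳ; ∈-++⁻)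
  open import Data.Product.Properties using (,-injective)
  open Relation.Binary.PropositionalEquality.≡-Reasoning

  increasingPairs : ∀ m → List (Fin m × Fin m)
  increasingPairs zero = []
  increasingPairs (suc m) = map (λ l → zero , suc l) (allFin m) ++ map (λ (k , l) → suc k , suc l) (increasingPairs m)

  ∈-increasingPairs⁻ : ∀ m {k l} → (k , l) ∈ increasingPairs m → k < l
  ∈-increasingPairs⁻ (suc m) kl∈ with ∈-++⁻ (map (λ l → zero , suc l) (allFin m)) kl∈
  ... | inj₁ kl∈first with ∈-map⁻ (λ l → zero , suc l) kl∈first
  ...   | _ , _ , refl = s≤s z≤n
  ∈-increasingPairs⁻ (suc m) kl∈ | inj₂ kl∈rest with ∈-map⁻ (λ (k , l) → suc k , suc l) kl∈rest
  ...   | _ , kl′∈ , refl = s≤s (∈-increasingPairs⁻ m kl′∈)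

  ∈-increasingPairs⁺ : ∀ m {k l : Fin m} → k < l → (k , l) ∈ increasingPairs m
  ∈-increasingPairs⁺ (suc m) {zero} {suc l} _ = ∈-++⁺ˡ (∈-map⁺ (λ l → zero , suc l) (∈-allFin l))
  ∈-increasingPairs⁺ (suc m) {suc k} {suc l} (s≤s k<l) =
    ∈-++⁺ʳ _ (∈-map⁺ (λ (k , l) → suc k , suc l) (∈-increasingPairs⁺ m k<l))

  increasingPairs-Unique : ∀ m → Unique (increasingPairs m)
  increasingPairs-Unique zero = []
  increasingPairs-Unique (suc m) =
    ++⁺ (map⁺ (suc-injective ∘ proj₂ ∘ ,-injective) (allFin⁺ m))
        (map⁺ (λ eq → let (k≡ , l≡) = ,-injective eq in cong₂ _,_ (suc-injective k≡) (suc-injective l≡))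
              (increasingPairs-Unique m))
        disjoint
    where
    disjoint : ∀ {x} → ¬ (x ∈ map (λ l → zero , suc l) (allFin m) × x ∈ map (λ (k , l) → suc k , suc l) (increasingPairs m))
    disjoint (first , rest) with ∈-map⁻ (λ l → zero , suc l) first | ∈-map⁻ (λ (k , l) → suc k , suc l) rest
    ... | _ , _ , refl | _ , _ , ()

  length-increasingPairs : ∀ m → length (increasingPairs m) ≡ m C 2
  length-increasingPairs zero = refl
  length-increasingPairs (suc m) = begin
    length (map (λ l → zero , suc l) (allFin m) ++ map (λ (k , l) → suc k , suc l) (increasingPairs m))
      ≡⟨ length-++ (map (λ l → zero , suc l) (allFin m)) ⟩
    length (map (λ l → zero , suc l) (allFin m)) + length (map (λ (k , l) → suc k , suc l) (increasingPairs m))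
      ≡⟨ cong₂ _+_ (trans (length-map _ (allFin m)) (length-tabulate id))
                   (trans (length-map _ (increasingPairs m)) (length-increasingPairs m)) ⟩
    m + m C 2       ≡⟨ cong (_+ m C 2) (sym (nC1≡n m)) ⟩
    m C 1 + m C 2   ≡⟨ nCk+nC[k+1]≡[n+1]C[k+1] m 1 ⟩
    suc m C 2       ∎

module AffineIndependence where

  open import Algebra.Bundles using (CommutativeMonoid; CommutativeRing)
  open import Data.Nat using (_≤_)
  open import Data.Nat.Properties using (<-irrefl)
  open import Data.Fin using (punchIn)
  open import Data.Fin.Properties using (punchInᵢ≢i)
  open import Data.Fin.Subset using (∣_∣; _⊆_)
  open import Data.Fin.Subset.Properties using (_∈?_; p⊆q⇒∣p∣≤∣q∣)
  open import Data.List using (tabulate)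
  open import Data.Rational using (ℚ; 0ℚ; 1ℚ; _+_; _*_)
  open import Data.Rational.Properties
    using (+-identityˡ; +-identityʳ; *-comm; *-zeroˡ; *-zeroʳ; *-identityʳ; *-distribˡ-+;
           *-1-commutativeMonoid; +-*-commutativeRing)
  open import Algebra.Properties.CommutativeSemigroup (CommutativeMonoid.commutativeSemigroup *-1-commutativeMonoid)
    using (x∙yz≈y∙xz)
  open import Algebra.Properties.Semiring.Sum (CommutativeRing.semiring +-*-commutativeRing)
    using (sum; sum-syntax; sum-cong-≗; sum-replicate-zero; sum-remove; ∑-distrib-+; ∑-comm; *-distribˡ-sum)
  open Relation.Binary.PropositionalEquality.≡-Reasoning

  sumℚ-tabulate : ∀ {A : Set} {m} (g : Fin m → A) (f : A → ℚ) → sumℚ (tabulate g) f ≡ ∑[ k < m ] f (g k)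
  sumℚ-tabulate {m = zero} g f = refl
  sumℚ-tabulate {m = suc m} g f = cong (f (g zero) +_) (sumℚ-tabulate (g ∘ suc) f)

  sumℚ-allFin : ∀ {m} (f : Fin m → ℚ) → sumℚ (allFin m) f ≡ ∑[ k < m ] f k
  sumℚ-allFin = sumℚ-tabulate id

  ∑-zero : ∀ {m} (f : Fin m → ℚ) → (∀ k → f k ≡ 0ℚ) → ∑[ k < m ] f k ≡ 0ℚ
  ∑-zero {m} f f≡0 = trans (sum-cong-≗ f≡0) (sum-replicate-zero m)

  ∑-point : ∀ {m} (f : Fin m → ℚ) j → (∀ k → k ≢ j → f k ≡ 0ℚ) → ∑[ k < m ] f k ≡ f j
  ∑-point {suc _} f j off-j = begin
    sum f                          ≡⟨ sum-remove {i = j} f ⟩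
    f j + sum (f ∘ punchIn j)      ≡⟨ cong (f j +_) (∑-zero _ (λ k → off-j _ (punchInᵢ≢i j k))) ⟩
    f j + 0ℚ                       ≡⟨ +-identityʳ (f j) ⟩
    f j                            ∎

  δ : ∀ {n} → Fin n → Fin n → ℚ
  δ i k = if does (k ≟ i) then 1ℚ else 0ℚ

  δ-diag : ∀ {n} (i : Fin n) → δ i i ≡ 1ℚ
  δ-diag i with i ≟ i
  ... | yes _ = refl
  ... | no i≢i = ⊥-elim (i≢i refl)

  δ-off : ∀ {n} {i k : Fin n} → k ≢ i → δ i k ≡ 0ℚ
  δ-off {i = i} {k} k≢i with k ≟ i
  ... | yes k≡i = ⊥-elim (k≢i k≡i)
  ... | no _ = refl

  ∑-*δ : ∀ {n} (w : Pt n) i → ∑[ k < n ] (w k * δ i k) ≡ w i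
  ∑-*δ w i = begin
    ∑[ k < _ ] (w k * δ i k)   ≡⟨ ∑-point _ i (λ k k≢i → trans (cong (w k *_) (δ-off k≢i)) (*-zeroʳ (w k))) ⟩
    w i * δ i i                ≡⟨ cong (w i *_) (δ-diag i) ⟩
    w i * 1ℚ                   ≡⟨ *-identityʳ (w i) ⟩
    w i                        ∎

  dot-eij : ∀ {n} (w : Pt n) {i j : Fin n} → i ≢ j → dot w (eij (i , j)) ≡ w i + w j
  dot-eij {n} w {i} {j} i≢j = begin
    dot w (eij (i , j))                                  ≡⟨ sumℚ-allFin (λ k → w k * eij (i , j) k) ⟩
    ∑[ k < n ] (w k * eij (i , j) k)                 ≡⟨ sum-cong-≗ split ⟩
    ∑[ k < n ] (w k * δ i k + w k * δ j k)           ≡⟨ ∑-distrib-+ (λ k → w k * δ i k) _ ⟩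
    ∑[ k < n ] (w k * δ i k) + ∑[ k < n ] (w k * δ j k) ≡⟨ cong₂ _+_ (∑-*δ w i) (∑-*δ w j) ⟩
    w i + w j                                            ∎
    where
    split : ∀ k → w k * eij (i , j) k ≡ w k * δ i k + w k * δ j k
    split k with k ≟ i | k ≟ j
    ... | yes refl | yes refl = ⊥-elim (i≢j refl)
    ... | yes _ | no _ = sym (trans (cong (w k * 1ℚ +_) (*-zeroʳ (w k))) (+-identityʳ _))
    ... | no _ | yes _ = sym (trans (cong (_+ w k * 1ℚ) (*-zeroʳ (w k))) (+-identityˡ _))
    ... | no _ | no _ = trans (*-zeroʳ (w k)) (sym (cong₂ _+_ (*-zeroʳ (w k)) (*-zeroʳ (w k))))

  module _ {m n : ℕ} (p : Fin m → Pt n) where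

    ∑-affine : ∀ (λ′ : Fin m → ℚ) (w : Pt n) β →
      ∑[ k < m ] (λ′ k * (dot w (p k) + β)) ≡
      dot w (λ i → sumℚ (allFin m) (λ k → λ′ k * p k i)) + β * sumℚ (allFin m) λ′
    ∑-affine λ′ w β = begin
      ∑[ k < m ] (λ′ k * (dot w (p k) + β))
        ≡⟨ sum-cong-≗ (λ k → *-distribˡ-+ (λ′ k) (dot w (p k)) β) ⟩
      ∑[ k < m ] (λ′ k * dot w (p k) + λ′ k * β)
        ≡⟨ ∑-distrib-+ (λ k → λ′ k * dot w (p k)) (λ k → λ′ k * β) ⟩
      ∑[ k < m ] (λ′ k * dot w (p k)) + ∑[ k < m ] (λ′ k * β)
        ≡⟨ cong₂ _+_ linear constant ⟩
      dot w (λ i → sumℚ (allFin m) (λ k → λ′ k * p k i)) + β * sumℚ (allFin m) λ′ ∎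
      where
      linear : ∑[ k < m ] (λ′ k * dot w (p k)) ≡ dot w (λ i → sumℚ (allFin m) (λ k → λ′ k * p k i))
      linear = begin
        ∑[ k < m ] (λ′ k * dot w (p k))
          ≡⟨ sum-cong-≗ (λ k → trans (cong (λ′ k *_) (sumℚ-allFin (λ i → w i * p k i)))
                                     (*-distribˡ-sum (λ′ k) (λ i → w i * p k i))) ⟩
        ∑[ k < m ] ∑[ i < n ] (λ′ k * (w i * p k i))
          ≡⟨ ∑-comm (λ k i → λ′ k * (w i * p k i)) ⟩
        ∑[ i < n ] ∑[ k < m ] (λ′ k * (w i * p k i))
          ≡⟨ sum-cong-≗ (λ i → trans (sum-cong-≗ (λ k → x∙yz≈y∙xz (λ′ k) (w i) (p k i)))
                                     (sym (*-distribˡ-sum (w i) (λ k → λ′ k * p k i)))) ⟩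
        ∑[ i < n ] (w i * ∑[ k < m ] (λ′ k * p k i))
          ≡⟨ sym (trans (sumℚ-allFin (λ i → w i * sumℚ (allFin m) (λ k → λ′ k * p k i)))
                         (sum-cong-≗ (λ i → cong (w i *_) (sumℚ-allFin (λ k → λ′ k * p k i))))) ⟩
        dot w (λ i → sumℚ (allFin m) (λ k → λ′ k * p k i)) ∎
      constant : ∑[ k < m ] (λ′ k * β) ≡ β * sumℚ (allFin m) λ′
      constant = begin
        ∑[ k < m ] (λ′ k * β)  ≡⟨ sum-cong-≗ (λ k → *-comm (λ′ k) β) ⟩
        ∑[ k < m ] (β * λ′ k)  ≡⟨ sym (*-distribˡ-sum β λ′) ⟩
        β * ∑[ k < m ] λ′ k    ≡⟨ cong (β *_) (sym (sumℚ-allFin λ′)) ⟩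
        β * sumℚ (allFin m) λ′ ∎

    -- Applying the functional dual to p k to a vanishing affine combination of the points of T shows that
    -- its coefficient at k vanishes.
    affIndep-byDualFunctionals : (T : Subset m) →
      (∀ k → k Subset.∈ T → Σ (Pt n) λ w → Σ ℚ λ β → ∀ k′ → k′ Subset.∈ T → dot w (p k′) + β ≡ δ k k′) →
      AffIndep p T
    affIndep-byDualFunctionals T dual λ′ off-T ∑λ′≡0 ∑λ′p≡0 k with k ∈? T
    ... | no k∉T = off-T k k∉T
    ... | yes k∈T with dual k k∈T
    ... | w , β , w-dual = begin
      λ′ k                                               ≡⟨ sym (∑-*δ λ′ k) ⟩
      ∑[ k′ < m ] (λ′ k′ * δ k k′)                       ≡⟨ sum-cong-≗ dual-on-support ⟩
      ∑[ k′ < m ] (λ′ k′ * (dot w (p k′) + β))           ≡⟨ ∑-affine λ′ w β ⟩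
      dot w (λ i → sumℚ (allFin m) (λ k′ → λ′ k′ * p k′ i)) + β * sumℚ (allFin m) λ′
        ≡⟨ cong₂ (λ x y → x + β * y) dot-zero ∑λ′≡0 ⟩
      0ℚ + β * 0ℚ                                        ≡⟨ cong (0ℚ +_) (*-zeroʳ β) ⟩
      0ℚ                                                 ∎
      where
      dual-on-support : ∀ k′ → λ′ k′ * δ k k′ ≡ λ′ k′ * (dot w (p k′) + β)
      dual-on-support k′ with k′ ∈? T
      ... | yes k′∈T = cong (λ′ k′ *_) (sym (w-dual k′ k′∈T))
      ... | no k′∉T rewrite off-T k′ k′∉T = trans (*-zeroˡ (δ k k′)) (sym (*-zeroˡ (dot w (p k′) + β)))
      dot-zero : dot w (λ i → sumℚ (allFin m) (λ k′ → λ′ k′ * p k′ i)) ≡ 0ℚ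
      dot-zero = trans (sumℚ-allFin (λ i → w i * sumℚ (allFin m) (λ k′ → λ′ k′ * p k′ i)))
                       (∑-zero _ (λ i → trans (cong (w i *_) (∑λ′p≡0 i)) (*-zeroʳ (w i))))

    affIndep⇒affDim : ∀ {S d} → AffIndep p S → ∣ S ∣ ≡ suc d → AffDim p S d
    affIndep⇒affDim {S} indep size = (S , id , indep , size) , λ T T⊆S _ → subst (∣ T ∣ ≤_) size (p⊆q⇒∣p∣≤∣q∣ T⊆S)

    affDim-tooBig : ∀ {S T d} → AffDim p S d → T ⊆ S → AffIndep p T → ∣ T ∣ ≡ suc (suc d) → ⊥
    affDim-tooBig (_ , bound) T⊆S indep size = <-irrefl refl (subst (_≤ _) size (bound _ T⊆S indep))

module EdgeList {n : ℕ} (G : SimpleGraph n) where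

  open import Data.List using ([_]; lookup)
  open import Data.List.Relation.Unary.Any using (index)
  open import Data.List.Relation.Unary.Any.Properties using (lookup-index)
  open import Data.List.Relation.Unary.Unique.Propositional using (Unique)
  open import Data.List.Relation.Unary.Unique.Propositional.Properties using (allFin⁺)
  open import Data.List.Membership.Propositional.Properties using (∈-allFin; ∈-lookup)
  open import Data.Rational using (_+_)
  open Lists
  open FinOrder
  open AffineIndependence using (dot-eij)

  edgesFrom : Fin n → Fin n → List (Fin n × Fin n)
  edgesFrom i j = if (i <ᶠ j) ∧ adj G i j then [ (i , j) ] else []

  row : Fin n → List (Fin n × Fin n)
  row i = concatMap (edgesFrom i) (allFin n)

  ∈-edgesFrom⁻ : ∀ i j {x} → x ∈ edgesFrom i j → x ≡ (i , j) × T (i <ᶠ j) × adj G i j ≡ true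
  ∈-edgesFrom⁻ i j x∈ with ∈-guarded⁻ ((i <ᶠ j) ∧ adj G i j) x∈
  ... | x≡ , guard with Equivalence.to T-∧ guard
  ...   | i<j , i~j = x≡ , i<j , Equivalence.to T-≡ i~j

  ∈-edges⁻ : ∀ {i j} → (i , j) ∈ edges G → T (i <ᶠ j) × adj G i j ≡ true
  ∈-edges⁻ ij∈ with ∈-concatMap⁻′ row (allFin n) ij∈
  ... | i′ , _ , ij∈row with ∈-concatMap⁻′ (edgesFrom i′) (allFin n) ij∈row
  ...   | j′ , _ , ij∈′ with ∈-edgesFrom⁻ i′ j′ ij∈′
  ...     | refl , i<j , i~j = i<j , i~j

  ∈-edges⁺ : ∀ {i j} → T (i <ᶠ j) → adj G i j ≡ true → (i , j) ∈ edges G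
  ∈-edges⁺ {i} {j} i<j i~j =
    ∈-concatMap⁺′ row (∈-allFin i) (∈-concatMap⁺′ (edgesFrom i) (∈-allFin j)
      (∈-guarded⁺ (Equivalence.from T-∧ (i<j , Equivalence.from T-≡ i~j))))

  edges-Unique : Unique (edges G)
  edges-Unique = Unique-concatMap row proj₁ row-key row-Unique (allFin⁺ n)
    where
    row-Unique : ∀ i → Unique (row i)
    row-Unique i = Unique-concatMap (edgesFrom i) proj₂ (λ j _ x∈ → cong proj₂ (proj₁ (∈-edgesFrom⁻ i j x∈)))
                                    (λ j → guarded-Unique ((i <ᶠ j) ∧ adj G i j)) (allFin⁺ n)
    row-key : ∀ i x → x ∈ row i → proj₁ x ≡ i
    row-key i x x∈ with ∈-concatMap⁻′ (edgesFrom i) (allFin n) x∈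
    ... | j , _ , x∈′ = cong proj₁ (proj₁ (∈-edgesFrom⁻ i j x∈′))

  ends : Fin (e G) → Fin n × Fin n
  ends k = lookup (edges G) k

  lo hi : Fin (e G) → Fin n
  lo k = proj₁ (ends k)
  hi k = proj₂ (ends k)

  lo<hi : ∀ k → T (lo k <ᶠ hi k)
  lo<hi k = proj₁ (∈-edges⁻ (∈-lookup k))

  lo≢hi : ∀ k → lo k ≢ hi k
  lo≢hi k = <ᶠ⇒≢ (lo<hi k)

  adj-lo-hi : ∀ k → adj G (lo k) (hi k) ≡ true
  adj-lo-hi k = proj₂ (∈-edges⁻ (∈-lookup k))

  ends-injective : ∀ {k l} → ends k ≡ ends l → k ≡ l
  ends-injective = lookup-injective edges-Unique

  edgeIndex : ∀ {i j} → T (i <ᶠ j) → adj G i j ≡ true → ∃[ k ] (ends k ≡ (i , j))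
  edgeIndex {i} {j} i<j i~j = index ij∈ , sym (lookup-index ij∈)
    where
    ij∈ : (i , j) ∈ edges G
    ij∈ = ∈-edges⁺ i<j i~j

  dot-edgeGen : ∀ (w : Pt n) k → dot w (edgeGen G k) ≡ w (lo k) + w (hi k)
  dot-edgeGen w k = dot-eij w (lo≢hi k)

module Slots where

  open import Data.Fin using (fromℕ; inject₁)
  open import Data.Fin.Properties using (suc-injective; all?)
  open import Data.Rational using (ℚ; _+_; _≤_)
  open import Data.Rational.Properties using (_≤?_) renaming (_≟_ to _≟ℚ_)
  open import Data.Vec using (Vec; []; _∷_; lookup)
  open import Data.Vec.Relation.Unary.All.Properties using (lookup⁺)
  open import Data.Vec.Relation.Unary.Unique.Propositional using (Unique; _∷_)
  open import Relation.Nullary.Decidable using (map′)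

  module _ {n : ℕ} where

    -- The position of v in the list xs of distinguished vertices, or r if v is not among them.
    slot : ∀ {r} → Vec (Fin n) r → Fin n → Fin (suc r)
    slot [] v = zero
    slot (x ∷ xs) v = if does (v ≟ x) then zero else suc (slot xs v)

    slot-inject₁ : ∀ {r} (xs : Vec (Fin n) r) v i → slot xs v ≡ inject₁ i → v ≡ lookup xs i
    slot-inject₁ (x ∷ xs) v i eq with v ≟ x | i
    ... | yes v≡x | zero = v≡x
    ... | no _ | suc i = slot-inject₁ xs v i (suc-injective eq)

    slot-injectiveOn : ∀ {r} (xs : Vec (Fin n) r) u v → slot xs u ≡ slot xs v → slot xs u ≢ fromℕ r → u ≡ v
    slot-injectiveOn [] u v _ distinguished = ⊥-elim (distinguished refl)
    slot-injectiveOn (x ∷ xs) u v eq distinguished with u ≟ x | v ≟ x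
    ... | yes u≡x | yes v≡x = trans u≡x (sym v≡x)
    ... | no _ | no _ = slot-injectiveOn xs u v (suc-injective eq) (distinguished ∘ cong suc)

    slot-lookup : ∀ {r} {xs : Vec (Fin n) r} → Unique xs → ∀ i → slot xs (lookup xs i) ≡ inject₁ i
    slot-lookup {xs = x ∷ xs} _ zero with x ≟ x
    ... | yes _ = refl
    ... | no x≢x = ⊥-elim (x≢x refl)
    slot-lookup {xs = x ∷ xs} (x∉ ∷ xs!) (suc i) with lookup xs i ≟ x
    ... | yes xᵢ≡x = ⊥-elim (lookup⁺ x∉ i (sym xᵢ≡x))
    ... | no _ = cong suc (slot-lookup xs! i)

  module _ {r : ℕ} where

    SlotPair : Fin r → Fin r → Fin (suc r) → Fin (suc r) → Set
    SlotPair i j c d = (c ≡ inject₁ i × d ≡ inject₁ j) ⊎ (c ≡ inject₁ j × d ≡ inject₁ i)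

    slotPair? : ∀ i j c d → Dec (SlotPair i j c d)
    slotPair? i j c d = (c ≟ inject₁ i ×-dec d ≟ inject₁ j) ⊎-dec (c ≟ inject₁ j ×-dec d ≟ inject₁ i)

    LoopSlot : Fin (suc r) → Fin (suc r) → Set
    LoopSlot c d = c ≡ d × c ≢ fromℕ r

    loopSlot? : ∀ c d → Dec (LoopSlot c d)
    loopSlot? c d = c ≟ d ×-dec ¬? (c ≟ fromℕ r)

    Exposes : (weight : Fin (suc r) → ℚ) (bound : ℚ) (P : Set) (c d : Fin (suc r)) → Set
    Exposes weight bound P c d =
      weight c + weight d ≤ bound × (weight c + weight d ≡ bound → P) × (P → weight c + weight d ≡ bound)

    -- Slot weights exposing exactly the slot pairs {i₀, j₀} and {i₁, j₁}, among the slot pairs that can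
    -- occur at an edge.
    record ExposingTable (weight : Fin (suc r) → ℚ) (bound : ℚ) (NonEdge : Fin (suc r) → Fin (suc r) → Set)
                         (i₀ j₀ i₁ j₁ : Fin r) : Set where
      constructor exposingTable
      field
        exposes : ∀ c d → ¬ (LoopSlot c d ⊎ NonEdge c d) →
                  Exposes weight bound (SlotPair i₀ j₀ c d ⊎ SlotPair i₁ j₁ c d) c d

    exposingTable? : ∀ weight bound {NonEdge} → (∀ c d → Dec (NonEdge c d)) → ∀ i₀ j₀ i₁ j₁ →
                     Dec (ExposingTable weight bound NonEdge i₀ j₀ i₁ j₁)
    exposingTable? weight bound nonEdge? i₀ j₀ i₁ j₁ = map′ exposingTable ExposingTable.exposes (all? λ c → all? λ d →
      ¬? (loopSlot? c d ⊎-dec nonEdge? c d) →-dec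
        (weight c + weight d ≤? bound ×-dec (weight c + weight d ≟ℚ bound →-dec tight? c d)
                                      ×-dec (tight? c d →-dec weight c + weight d ≟ℚ bound)))
      where
      tight? : ∀ c d → Dec (SlotPair i₀ j₀ c d ⊎ SlotPair i₁ j₁ c d)
      tight? c d = slotPair? i₀ j₀ c d ⊎-dec slotPair? i₁ j₁ c d

module Joining {n : ℕ} (G : SimpleGraph n) where

  open import Data.Fin.Properties using (<-asym; <-cmp)
  open import Data.Rational using (_+_)
  open import Data.Rational.Properties using (+-comm)
  open import Relation.Binary using (tri<; tri≈; tri>)
  open EdgeList G
  open FinOrder

  Joins : Fin (e G) → Fin n → Fin n → Set
  Joins k a b = (lo k ≡ a × hi k ≡ b) ⊎ (lo k ≡ b × hi k ≡ a)

  joins-lo-hi : ∀ k → Joins k (lo k) (hi k)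
  joins-lo-hi k = inj₁ (refl , refl)

  joins-hi-lo : ∀ k → Joins k (hi k) (lo k)
  joins-hi-lo k = inj₂ (refl , refl)

  Joins⇒≢ : ∀ {k a b} → Joins k a b → a ≢ b
  Joins⇒≢ {k} (inj₁ (refl , refl)) = lo≢hi k
  Joins⇒≢ {k} (inj₂ (refl , refl)) = lo≢hi k ∘ sym

  Joins-injective : ∀ {a b k l} → Joins k a b → Joins l a b → k ≡ l
  Joins-injective (inj₁ (refl , refl)) (inj₁ (lo≡ , hi≡)) = ends-injective (sym (cong₂ _,_ lo≡ hi≡))
  Joins-injective (inj₂ (refl , refl)) (inj₂ (lo≡ , hi≡)) = ends-injective (sym (cong₂ _,_ lo≡ hi≡))
  Joins-injective {k = k} (inj₁ (refl , refl)) (inj₂ (lo≡ , hi≡)) =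
    ⊥-elim (<-asym (<ᶠ⇒< (lo<hi k)) (subst₂ _<_ lo≡ hi≡ (<ᶠ⇒< (lo<hi _))))
  Joins-injective {k = k} (inj₂ (refl , refl)) (inj₁ (lo≡ , hi≡)) =
    ⊥-elim (<-asym (<ᶠ⇒< (lo<hi k)) (subst₂ _<_ lo≡ hi≡ (<ᶠ⇒< (lo<hi _))))

  Joins-unique : ∀ {k a b c d} → Joins k a b → Joins k c d → (a ≡ c × b ≡ d) ⊎ (a ≡ d × b ≡ c)
  Joins-unique (inj₁ (refl , refl)) (inj₁ (refl , refl)) = inj₁ (refl , refl)
  Joins-unique (inj₁ (refl , refl)) (inj₂ (refl , refl)) = inj₂ (refl , refl)
  Joins-unique (inj₂ (refl , refl)) (inj₁ (refl , refl)) = inj₂ (refl , refl)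
  Joins-unique (inj₂ (refl , refl)) (inj₂ (refl , refl)) = inj₁ (refl , refl)

  joinsEdge : ∀ {x y} → x ≢ y → adj G x y ≡ true → ∃[ k ] Joins k x y
  joinsEdge {x} {y} x≢y x~y with <-cmp x y
  ... | tri< x<y _ _ = let (k , ends≡) = edgeIndex (<⇒<ᶠ x<y) x~y in k , inj₁ (cong proj₁ ends≡ , cong proj₂ ends≡)
  ... | tri≈ _ x≡y _ = ⊥-elim (x≢y x≡y)
  ... | tri> _ _ y<x = let (k , ends≡) = edgeIndex (<⇒<ᶠ y<x) (trans (SimpleGraph.sym G y x) x~y) in
                        k , inj₂ (cong proj₁ ends≡ , cong proj₂ ends≡)

  dot-Joins : ∀ (w : Pt n) {k a b} → Joins k a b → dot w (edgeGen G k) ≡ w a + w b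
  dot-Joins w {k} (inj₁ (refl , refl)) = dot-edgeGen w k
  dot-Joins w {k} (inj₂ (refl , refl)) = trans (dot-edgeGen w k) (+-comm (w (lo k)) (w (hi k)))

module SlotFaces {n : ℕ} (G : SimpleGraph n) where

  open import Data.Rational using (ℚ; _≤_)
  open import Data.Vec using (Vec; lookup)
  open import Data.Vec.Relation.Unary.Unique.Propositional using (Unique)
  open EdgeList G
  open Joining G
  open Slots
  open Booleans using (true≢false)

  module _ {r} {xs : Vec (Fin n) r} (xs! : Unique xs) where

    AtEdge : (Fin (suc r) → Fin (suc r) → Set) → Fin (e G) → Set
    AtEdge R k = R (slot xs (lo k)) (slot xs (hi k))

    slotPair-sound : ∀ i j k → AtEdge (SlotPair i j) k → Joins k (lookup xs i) (lookup xs j)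
    slotPair-sound i j k (inj₁ (lo≡i , hi≡j)) = inj₁ (slot-inject₁ xs _ i lo≡i , slot-inject₁ xs _ j hi≡j)
    slotPair-sound i j k (inj₂ (lo≡j , hi≡i)) = inj₂ (slot-inject₁ xs _ j lo≡j , slot-inject₁ xs _ i hi≡i)

    slotPair-complete : ∀ i j k → Joins k (lookup xs i) (lookup xs j) → AtEdge (SlotPair i j) k
    slotPair-complete i j k (inj₁ (lo≡ , hi≡)) rewrite lo≡ | hi≡ = inj₁ (slot-lookup xs! i , slot-lookup xs! j)
    slotPair-complete i j k (inj₂ (lo≡ , hi≡)) rewrite lo≡ | hi≡ = inj₂ (slot-lookup xs! j , slot-lookup xs! i)

    ¬loopSlot : ∀ k → ¬ AtEdge LoopSlot k
    ¬loopSlot k (same , distinguished) = lo≢hi k (slot-injectiveOn xs _ _ same distinguished)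

    ¬slotPair-nonadjacent : ∀ i j → adj G (lookup xs i) (lookup xs j) ≡ false → ∀ k → ¬ AtEdge (SlotPair i j) k
    ¬slotPair-nonadjacent i j nonadjacent k pair with slotPair-sound i j k pair
    ... | inj₁ (lo≡ , hi≡) = true≢false (trans (sym (adj-lo-hi k)) (trans (cong₂ (adj G) lo≡ hi≡) nonadjacent))
    ... | inj₂ (lo≡ , hi≡) = true≢false (trans (sym (adj-lo-hi k))
                               (trans (cong₂ (adj G) lo≡ hi≡) (trans (SimpleGraph.sym G _ _) nonadjacent)))

    isFace-bySlots : (weight : Fin (suc r) → ℚ) (bound : ℚ) {NonEdge : Fin (suc r) → Fin (suc r) → Set}
      (i₀ j₀ i₁ j₁ : Fin r) → ExposingTable weight bound NonEdge i₀ j₀ i₁ j₁ → (∀ k → ¬ AtEdge NonEdge k) →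
      ∀ {k₀ k₁} → Joins k₀ (lookup xs i₀) (lookup xs j₀) → Joins k₁ (lookup xs i₁) (lookup xs j₁) →
      (S : Subset (e G)) → (∀ k → k Subset.∈ S ⇔ (k ≡ k₀ ⊎ k ≡ k₁)) → IsFace (edgeGen G) S
    isFace-bySlots weight bound i₀ j₀ i₁ j₁ table nonEdge-free {k₀} {k₁} joins₀ joins₁ S S≡ =
      (k₀ , Equivalence.from (S≡ k₀) (inj₁ refl)) , w , bound , below , λ k → mk⇔ (tight⇒∈S k) (∈S⇒tight k)
      where
      w : Pt n
      w v = weight (slot xs v)
      exposes : ∀ k → Exposes weight bound (AtEdge (SlotPair i₀ j₀) k ⊎ AtEdge (SlotPair i₁ j₁) k)
                                          (slot xs (lo k)) (slot xs (hi k))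
      exposes k = ExposingTable.exposes table _ _ [ ¬loopSlot k , nonEdge-free k ]
      below : ∀ k → dot w (edgeGen G k) ≤ bound
      below k = subst (_≤ bound) (sym (dot-edgeGen w k)) (proj₁ (exposes k))
      tight⇒∈S : ∀ k → dot w (edgeGen G k) ≡ bound → k Subset.∈ S
      tight⇒∈S k tight with proj₁ (proj₂ (exposes k)) (trans (sym (dot-edgeGen w k)) tight)
      ... | inj₁ pair = Equivalence.from (S≡ k) (inj₁ (Joins-injective (slotPair-sound i₀ j₀ k pair) joins₀))
      ... | inj₂ pair = Equivalence.from (S≡ k) (inj₂ (Joins-injective (slotPair-sound i₁ j₁ k pair) joins₁))
      ∈S⇒tight : ∀ k → k Subset.∈ S → dot w (edgeGen G k) ≡ bound
      ∈S⇒tight k k∈S = trans (dot-edgeGen w k) (proj₂ (proj₂ (exposes k)) (pair (Equivalence.to (S≡ k) k∈S)))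
        where
        pair : k ≡ k₀ ⊎ k ≡ k₁ → AtEdge (SlotPair i₀ j₀) k ⊎ AtEdge (SlotPair i₁ j₁) k
        pair (inj₁ refl) = inj₁ (slotPair-complete i₀ j₀ k joins₀)
        pair (inj₂ refl) = inj₂ (slotPair-complete i₁ j₁ k joins₁)

module ExposingTables where

  open import Data.Fin using (#_)
  open import Data.Integer using (+_)
  open import Data.Rational using (ℚ; _/_)
  open import Data.Vec using (Vec; []; _∷_; lookup)
  open Slots

  weights : ∀ {m} → Vec ℕ m → Fin m → ℚ
  weights ws c = + lookup ws c / 1

  NoNonEdge : ∀ {r} → Fin r → Fin r → Set
  NoNonEdge _ _ = ⊥

  -- slots: the ends a and b of the edge, all other vertices
  vertexTable : ExposingTable (weights (1 ∷ 1 ∷ 0 ∷ [])) (+ 2 / 1) NoNonEdge (# 0) (# 1) (# 0) (# 1)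
  vertexTable = toWitness {a? = exposingTable? _ _ (λ _ _ → no λ ()) _ _ _ _} _

  -- slots: the common end a of the edges ab and ac, then b, c, all other vertices
  sharedEndTable : ExposingTable (weights (2 ∷ 1 ∷ 1 ∷ 0 ∷ [])) (+ 3 / 1) NoNonEdge (# 0) (# 1) (# 0) (# 2)
  sharedEndTable = toWitness {a? = exposingTable? _ _ (λ _ _ → no λ ()) _ _ _ _} _

  NonEdgeAtB : Fin 5 → Fin 5 → Set
  NonEdgeAtB c d = SlotPair (# 1) (# 2) c d ⊎ SlotPair (# 1) (# 3) c d

  -- slots: a, b, c, d for the edges ab and cd, where b is adjacent to neither c nor d, then all other vertices
  disjointTable : ExposingTable (weights (1 ∷ 3 ∷ 2 ∷ 2 ∷ 0 ∷ [])) (+ 4 / 1) NonEdgeAtB (# 0) (# 1) (# 2) (# 3)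
  disjointTable = toWitness {a? = exposingTable? _ _ (λ c d → slotPair? _ _ c d ⊎-dec slotPair? _ _ c d) _ _ _ _} _

module EdgeFaces {n : ℕ} (G : SimpleGraph n) where

  open import Data.Fin using (#_)
  open import Data.Fin.Subset.Properties using (x∈⁅x⁆)
  open import Data.Vec using ([]; _∷_)
  open import Data.Vec.Relation.Unary.All using ([]; _∷_)
  open import Data.Vec.Relation.Unary.Unique.Propositional using (Unique; []; _∷_)
  open EdgeList G
  open Joining G
  open SlotFaces G
  open ExposingTables
  open Subsets

  isFace-vertex : ∀ k → IsFace (edgeGen G) ⁅ k ⁆
  isFace-vertex k =
    isFace-bySlots ((lo≢hi k ∷ []) ∷ [] ∷ []) _ _ _ _ _ _ vertexTable (λ _ ()) (joins-lo-hi k) (joins-lo-hi k) ⁅ k ⁆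
                   (λ k′ → mk⇔ (inj₁ ∘ ∈-⁅⁆) λ { (inj₁ refl) → x∈⁅x⁆ k′ ; (inj₂ refl) → x∈⁅x⁆ k′ })

  isFace-sharedEnd : ∀ {a b c k l} → Unique (a ∷ b ∷ c ∷ []) → Joins k a b → Joins l a c →
                     IsFace (edgeGen G) (⁅ k ⁆ ∪ ⁅ l ⁆)
  isFace-sharedEnd abc! joins-k joins-l =
    isFace-bySlots abc! _ _ _ _ _ _ sharedEndTable (λ _ ()) joins-k joins-l _ (λ _ → ∈-⁅⁆∪⁅⁆)

  isFace-disjoint : ∀ {a b c d k l} → Unique (a ∷ b ∷ c ∷ d ∷ []) → adj G b c ≡ false → adj G b d ≡ false →
                    Joins k a b → Joins l c d → IsFace (edgeGen G) (⁅ k ⁆ ∪ ⁅ l ⁆)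
  isFace-disjoint abcd! b≁c b≁d joins-k joins-l =
    isFace-bySlots abcd! _ _ _ _ _ _ disjointTable
      (λ k → [ ¬slotPair-nonadjacent abcd! (# 1) (# 2) b≁c k , ¬slotPair-nonadjacent abcd! (# 1) (# 3) b≁d k ])
      joins-k joins-l _ (λ _ → ∈-⁅⁆∪⁅⁆)

module SmallAffIndep {n : ℕ} (G : SimpleGraph n) where

  open import Data.Rational using (ℚ; 0ℚ; 1ℚ; _+_; -_)
  open import Data.Rational.Properties using (+-identityʳ; +-0-commutativeMonoid)
  open import Algebra.Bundles using (CommutativeMonoid)
  open import Algebra.Properties.CommutativeSemigroup (CommutativeMonoid.commutativeSemigroup +-0-commutativeMonoid)
    using (interchange)
  open EdgeList G
  open Joining G using (joins-lo-hi; Joins-injective)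
  open AffineIndependence using (δ; δ-diag; δ-off; affIndep-byDualFunctionals)
  open Subsets using (∈-⁅⁆; ∈-⁅⁆∪⁅⁆; ∈-⁅⁆∪⁅⁆∪⁅⁆)

  Incident : Fin n → Fin (e G) → Set
  Incident v k = v ≡ lo k ⊎ v ≡ hi k

  incident? : ∀ v k → Dec (Incident v k)
  incident? v k = v ≟ lo k ⊎-dec v ≟ hi k

  dot-δ-incident : ∀ {v k} → Incident v k → dot (δ v) (edgeGen G k) ≡ 1ℚ
  dot-δ-incident {k = k} (inj₁ refl) =
    trans (dot-edgeGen (δ (lo k)) k) (cong₂ _+_ (δ-diag (lo k)) (δ-off (λ hi≡lo → lo≢hi k (sym hi≡lo))))
  dot-δ-incident {k = k} (inj₂ refl) = trans (dot-edgeGen (δ (hi k)) k) (cong₂ _+_ (δ-off (lo≢hi k)) (δ-diag (hi k)))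

  dot-δ-¬incident : ∀ {v k} → ¬ Incident v k → dot (δ v) (edgeGen G k) ≡ 0ℚ
  dot-δ-¬incident {v} {k} v∉k =
    trans (dot-edgeGen (δ v) k) (cong₂ _+_ (δ-off (v∉k ∘ inj₁ ∘ sym)) (δ-off (v∉k ∘ inj₂ ∘ sym)))

  dot-+ : ∀ (w w′ : Pt n) k → dot (λ x → w x + w′ x) (edgeGen G k) ≡ dot w (edgeGen G k) + dot w′ (edgeGen G k)
  dot-+ w w′ k = trans (dot-edgeGen (λ x → w x + w′ x) k)
    (trans (interchange (w (lo k)) (w′ (lo k)) (w (hi k)) (w′ (hi k)))
           (sym (cong₂ _+_ (dot-edgeGen w k) (dot-edgeGen w′ k))))

  Separates : Fin (e G) → (Fin (e G) → Set) → Set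
  Separates k Others =
    Σ (Pt n) λ w → Σ ℚ λ β → dot w (edgeGen G k) + β ≡ 1ℚ × (∀ l → Others l → dot w (edgeGen G l) + β ≡ 0ℚ)

  Separates-mono : ∀ {k} {Others Others′ : Fin (e G) → Set} →
                   (∀ l → Others′ l → Others l) → Separates k Others → Separates k Others′
  Separates-mono sub (w , β , at-k , at-others) = w , β , at-k , λ l o → at-others l (sub l o)

  affIndep-bySeparation : (T : Subset (e G)) → (∀ k → k Subset.∈ T → Separates k (λ l → l Subset.∈ T × l ≢ k)) →
                          AffIndep (edgeGen G) T
  affIndep-bySeparation T separate = affIndep-byDualFunctionals (edgeGen G) T dual
    where
    dual : ∀ k → k Subset.∈ T → Σ (Pt n) λ w → Σ ℚ λ β → ∀ k′ → k′ Subset.∈ T → dot w (edgeGen G k′) + β ≡ δ k k′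
    dual k k∈T with separate k k∈T
    ... | w , β , at-k , at-others = w , β , value
      where
      value : ∀ k′ → k′ Subset.∈ T → dot w (edgeGen G k′) + β ≡ δ k k′
      value k′ k′∈T with k′ ≟ k
      ... | yes refl = at-k
      ... | no k′≢k = at-others k′ (k′∈T , k′≢k)

  separatedBy-δ : ∀ {v k} {Others : Fin (e G) → Set} →
                  Incident v k → (∀ l → Others l → ¬ Incident v l) → Separates k Others
  separatedBy-δ {v} v∈k v∉others =
    δ v , 0ℚ , trans (+-identityʳ _) (dot-δ-incident v∈k) , λ l o → trans (+-identityʳ _) (dot-δ-¬incident (v∉others l o))

  privateEnd : ∀ {k l} → k ≢ l → ∃[ v ] (Incident v k × ¬ Incident v l)
  privateEnd {k} {l} k≢l with incident? (lo k) l | incident? (hi k) l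
  ... | no lo∉l | _ = lo k , inj₁ refl , lo∉l
  ... | yes _ | no hi∉l = hi k , inj₂ refl , hi∉l
  ... | yes (inj₁ lo≡lo) | yes (inj₁ hi≡lo) = ⊥-elim (lo≢hi k (trans lo≡lo (sym hi≡lo)))
  ... | yes (inj₂ lo≡hi) | yes (inj₂ hi≡hi) = ⊥-elim (lo≢hi k (trans lo≡hi (sym hi≡hi)))
  ... | yes (inj₁ lo≡lo) | yes (inj₂ hi≡hi) = ⊥-elim (k≢l (Joins-injective (joins-lo-hi k) (inj₁ (sym lo≡lo , sym hi≡hi))))
  ... | yes (inj₂ lo≡hi) | yes (inj₁ hi≡lo) = ⊥-elim (k≢l (Joins-injective (joins-lo-hi k) (inj₂ (sym hi≡lo , sym lo≡hi))))

  separate₂ : ∀ {k l} → k ≢ l → Separates k (_≡ l)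
  separate₂ k≢l with privateEnd k≢l
  ... | v , v∈k , v∉l = separatedBy-δ v∈k λ { _ refl → v∉l }

  -- If no end of k avoids both l and o, the two ends u, v of k split them and δ u + δ v - 1 separates k.
  separate₃ : ∀ {k l o} → k ≢ l → k ≢ o → Separates k (λ x → x ≡ l ⊎ x ≡ o)
  separate₃ {k} {l} {o} k≢l k≢o with privateEnd k≢l
  ... | v , v∈k , v∉l with incident? v o
  ... | no v∉o = separatedBy-δ v∈k λ { _ (inj₁ refl) → v∉l ; _ (inj₂ refl) → v∉o }
  ... | yes v∈o with privateEnd k≢o
  ... | u , u∈k , u∉o with incident? u l
  ... | no u∉l = separatedBy-δ u∈k λ { _ (inj₁ refl) → u∉l ; _ (inj₂ refl) → u∉o }
  ... | yes u∈l = (λ x → δ u x + δ v x) , - 1ℚ ,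
                  value k (dot-δ-incident u∈k) (dot-δ-incident v∈k) ,
                  λ { _ (inj₁ refl) → value l (dot-δ-incident u∈l) (dot-δ-¬incident v∉l)
                    ; _ (inj₂ refl) → value o (dot-δ-¬incident u∉o) (dot-δ-incident v∈o) }
    where
    value : ∀ x {a b} → dot (δ u) (edgeGen G x) ≡ a → dot (δ v) (edgeGen G x) ≡ b →
            dot (λ y → δ u y + δ v y) (edgeGen G x) + - 1ℚ ≡ a + b + - 1ℚ
    value x du dv = cong (_+ - 1ℚ) (trans (dot-+ (δ u) (δ v) x) (cong₂ _+_ du dv))

  affIndep-⁅⁆ : ∀ k → AffIndep (edgeGen G) ⁅ k ⁆
  affIndep-⁅⁆ k = affIndep-bySeparation ⁅ k ⁆ λ k₀ k₀∈ →
    (δ (lo k₀) , 0ℚ , trans (+-identityʳ _) (dot-δ-incident (inj₁ refl)) ,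
     λ l (l∈ , l≢k₀) → ⊥-elim (l≢k₀ (trans (∈-⁅⁆ l∈) (sym (∈-⁅⁆ k₀∈)))))

  affIndep-pair : ∀ {k l} → k ≢ l → AffIndep (edgeGen G) (⁅ k ⁆ ∪ ⁅ l ⁆)
  affIndep-pair {k} {l} k≢l = affIndep-bySeparation _ λ x x∈ → separate (Equivalence.to ∈-⁅⁆∪⁅⁆ x∈)
    where
    separate : ∀ {x} → x ≡ k ⊎ x ≡ l → Separates x (λ y → y Subset.∈ ⁅ k ⁆ ∪ ⁅ l ⁆ × y ≢ x)
    separate (inj₁ refl) = Separates-mono (λ y (y∈ , y≢k) → other y≢k (Equivalence.to ∈-⁅⁆∪⁅⁆ y∈)) (separate₂ k≢l)
      where other : ∀ {y} → y ≢ k → y ≡ k ⊎ y ≡ l → y ≡ l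
            other y≢k = λ { (inj₁ y≡k) → ⊥-elim (y≢k y≡k) ; (inj₂ y≡l) → y≡l }
    separate (inj₂ refl) = Separates-mono (λ y (y∈ , y≢l) → other y≢l (Equivalence.to ∈-⁅⁆∪⁅⁆ y∈)) (separate₂ (k≢l ∘ sym))
      where other : ∀ {y} → y ≢ l → y ≡ k ⊎ y ≡ l → y ≡ k
            other y≢l = λ { (inj₁ y≡k) → y≡k ; (inj₂ y≡l) → ⊥-elim (y≢l y≡l) }

  affIndep-triple : ∀ {k l o} → k ≢ l → k ≢ o → l ≢ o → AffIndep (edgeGen G) (⁅ k ⁆ ∪ (⁅ l ⁆ ∪ ⁅ o ⁆))
  affIndep-triple {k} {l} {o} k≢l k≢o l≢o = affIndep-bySeparation _ λ x x∈ → separate (Equivalence.to ∈-⁅⁆∪⁅⁆∪⁅⁆ x∈)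
    where
    triple : Subset (e G)
    triple = ⁅ k ⁆ ∪ (⁅ l ⁆ ∪ ⁅ o ⁆)
    separate : ∀ {x} → x ≡ k ⊎ x ≡ l ⊎ x ≡ o → Separates x (λ y → y Subset.∈ triple × y ≢ x)
    separate (inj₁ refl) = Separates-mono (λ y (y∈ , y≢k) → others y≢k (Equivalence.to ∈-⁅⁆∪⁅⁆∪⁅⁆ y∈)) (separate₃ k≢l k≢o)
      where others : ∀ {y} → y ≢ k → y ≡ k ⊎ y ≡ l ⊎ y ≡ o → y ≡ l ⊎ y ≡ o
            others y≢k = λ { (inj₁ y≡k) → ⊥-elim (y≢k y≡k) ; (inj₂ y≡) → y≡ }
    separate (inj₂ (inj₁ refl)) =
      Separates-mono (λ y (y∈ , y≢l) → others y≢l (Equivalence.to ∈-⁅⁆∪⁅⁆∪⁅⁆ y∈)) (separate₃ (k≢l ∘ sym) l≢o)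
      where others : ∀ {y} → y ≢ l → y ≡ k ⊎ y ≡ l ⊎ y ≡ o → y ≡ k ⊎ y ≡ o
            others y≢l = λ { (inj₁ y≡k) → inj₁ y≡k ; (inj₂ (inj₁ y≡l)) → ⊥-elim (y≢l y≡l) ; (inj₂ (inj₂ y≡o)) → inj₂ y≡o }
    separate (inj₂ (inj₂ refl)) =
      Separates-mono (λ y (y∈ , y≢o) → others y≢o (Equivalence.to ∈-⁅⁆∪⁅⁆∪⁅⁆ y∈)) (separate₃ (k≢o ∘ sym) (l≢o ∘ sym))
      where others : ∀ {y} → y ≢ o → y ≡ k ⊎ y ≡ l ⊎ y ≡ o → y ≡ k ⊎ y ≡ l
            others y≢o = λ { (inj₁ y≡k) → inj₁ y≡k ; (inj₂ (inj₁ y≡l)) → inj₂ y≡l ; (inj₂ (inj₂ y≡o)) → ⊥-elim (y≢o y≡o) }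

module Vertices {n : ℕ} (G : SimpleGraph n) where

  open import Data.Fin.Subset using (_⊆_)
  open import Data.Fin.Subset.Properties using (x∈⁅x⁆; ∣⁅x⁆∣≡1; ⊆-antisym)
  open import Data.List.Properties using (length-map; length-tabulate)
  open import Data.List.Relation.Unary.Unique.Propositional.Properties using (map⁺; allFin⁺)
  open import Data.List.Membership.Propositional.Properties using (∈-map⁺; ∈-map⁻; ∈-allFin)
  open EdgeFaces G using (isFace-vertex)
  open SmallAffIndep G using (affIndep-⁅⁆; affIndep-pair)
  open AffineIndependence using (affIndep⇒affDim; affDim-tooBig)
  open Subsets

  isDFace₀-⁅⁆ : ∀ k → IsDFace (edgeGen G) 0 ⁅ k ⁆
  isDFace₀-⁅⁆ k = isFace-vertex k , affIndep⇒affDim _ (affIndep-⁅⁆ k) (∣⁅x⁆∣≡1 k)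

  isDFace₀⇒≡⁅⁆ : ∀ {S} → IsDFace (edgeGen G) 0 S → ∃[ k ] (S ≡ ⁅ k ⁆)
  isDFace₀⇒≡⁅⁆ {S} (_ , dim@((T , T⊆S , _ , size) , _)) with nonempty T size
  ... | k , k∈T = k , ⊆-antisym S⊆⁅k⁆ (λ x∈ → subst (Subset._∈ S) (sym (∈-⁅⁆ x∈)) (T⊆S k∈T))
    where
    S⊆⁅k⁆ : S ⊆ ⁅ k ⁆
    S⊆⁅k⁆ {l} l∈S with l ≟ k
    ... | yes refl = x∈⁅x⁆ l
    ... | no l≢k = ⊥-elim (affDim-tooBig _ dim (⁅⁆∪⁅⁆⊆ (T⊆S k∈T) l∈S) (affIndep-pair (l≢k ∘ sym)) (∣⁅x⁆∪⁅y⁆∣ (l≢k ∘ sym)))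

  faceNumber₀ : FaceNumber (edgeGen G) 0 (e G)
  faceNumber₀ =
    map ⁅_⁆ (allFin (e G)) ,
    trans (length-map ⁅_⁆ (allFin (e G))) (length-tabulate id) ,
    map⁺ ⁅⁆-injective (allFin⁺ (e G)) ,
    λ S → mk⇔ (λ S∈ → let (k , _ , S≡) = ∈-map⁻ ⁅_⁆ S∈ in subst (IsDFace (edgeGen G) 0) (sym S≡) (isDFace₀-⁅⁆ k))
              (λ face → let (k , S≡) = isDFace₀⇒≡⁅⁆ face in
                        subst (_∈ map ⁅_⁆ (allFin (e G))) (sym S≡) (∈-map⁺ ⁅_⁆ (∈-allFin k)))

module VertexPairs where

  module _ {n : ℕ} where

    Disjoint : Fin n × Fin n → Fin n × Fin n → Set
    Disjoint (i , j) (i′ , j′) = i ≢ i′ × i ≢ j′ × j ≢ i′ × j ≢ j′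

    disjoint? : ∀ x y → Dec (Disjoint x y)
    disjoint? (i , j) (i′ , j′) = ¬? (i ≟ i′) ×-dec ¬? (i ≟ j′) ×-dec ¬? (j ≟ i′) ×-dec ¬? (j ≟ j′)

    Disjoint-sym : ∀ {x y} → Disjoint x y → Disjoint y x
    Disjoint-sym (i≢i′ , i≢j′ , j≢i′ , j≢j′) = i≢i′ ∘ sym , j≢i′ ∘ sym , i≢j′ ∘ sym , j≢j′ ∘ sym

  module _ {n : ℕ} (G : SimpleGraph n) where

    open import Data.Bool.Properties using (∧-comm)

    ≁-sym : ∀ {x y} → adj G x y ≡ false → adj G y x ≡ false
    ≁-sym {x} {y} x≁y = trans (SimpleGraph.sym G y x) x≁y

    -- the cross edges ii′, jj′ or ij′, ji′ that close the pairs {i, j} and {i′, j′} into a 4-cycle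
    crossed : Fin n × Fin n → Fin n × Fin n → Bool
    crossed (i , j) (i′ , j′) = (adj G i i′ ∧ adj G j j′) ∨ (adj G i j′ ∧ adj G j i′)

    crossed-sym : ∀ x y → crossed x y ≡ crossed y x
    crossed-sym (i , j) (i′ , j′)
      rewrite SimpleGraph.sym G i i′ | SimpleGraph.sym G j j′ | SimpleGraph.sym G i j′ | SimpleGraph.sym G j i′
      = cong (adj G i′ i ∧ adj G j′ j ∨_) (∧-comm (adj G j′ i) (adj G i′ j))

module EdgePairs {n : ℕ} (G : SimpleGraph n) where

  open import Data.Fin.Subset.Properties using (∪-comm)
  open import Data.Rational using (ℚ; _+_; _≤_)
  open import Data.Rational.Properties using (+-0-commutativeMonoid)
  open import Algebra.Bundles using (CommutativeMonoid)
  open import Algebra.Properties.CommutativeSemigroup (CommutativeMonoid.commutativeSemigroup +-0-commutativeMonoid)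
    using (interchange)
  open import Data.Vec using ([]; _∷_)
  open import Data.Vec.Relation.Unary.All using ([]; _∷_)
  open import Data.Vec.Relation.Unary.Unique.Propositional using ([]; _∷_)
  open EdgeList G
  open Joining G
  open EdgeFaces G
  open VertexPairs
  open Booleans
  open RationalOrder
  open Subsets using (∈-⁅⁆∪⁅⁆)

  Opposite : Fin (e G) → Fin (e G) → Set
  Opposite k l = Disjoint (ends k) (ends l) × T (crossed G (ends k) (ends l))

  opposite? : ∀ k l → Dec (Opposite k l)
  opposite? k l = disjoint? (ends k) (ends l) ×-dec T? (crossed G (ends k) (ends l))

  Opposite-sym : ∀ {k l} → Opposite k l → Opposite l k
  Opposite-sym {k} {l} (disjoint , cross) = Disjoint-sym disjoint , subst T (crossed-sym G (ends k) (ends l)) cross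

  -- p k + p l = e_a + e_b + e_c + e_d is also the sum of the generators of the cross edges ac and bd, so a
  -- supporting hyperplane through p k and p l passes through both of them as well.
  crossEdges⇒¬face : ∀ {a b c d k l} → Joins k a b → Joins l c d → Disjoint (a , b) (c , d) →
                      adj G a c ≡ true → adj G b d ≡ true → ¬ IsFace (edgeGen G) (⁅ k ⁆ ∪ ⁅ l ⁆)
  crossEdges⇒¬face {a} {b} {c} {d} {k} {l} joins-k joins-l (a≢c , a≢d , b≢c , b≢d) a~c b~d (_ , w , B , below , tight)
    with joinsEdge a≢c a~c | joinsEdge b≢d b~d
  ... | m , joins-m | m′ , joins-m′ = m∉ (Equivalence.to ∈-⁅⁆∪⁅⁆ (Equivalence.to (tight m) m-tight))
    where
    value : ∀ {x} {u v} → Joins x u v → x Subset.∈ ⁅ k ⁆ ∪ ⁅ l ⁆ → w u + w v ≡ B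
    value joins x∈ = trans (sym (dot-Joins w joins)) (Equivalence.from (tight _) x∈)
    m-tight : dot w (edgeGen G m) ≡ B
    m-tight = trans (dot-Joins w joins-m)
      (+≡B+B⇒≡B (subst (_≤ B) (dot-Joins w joins-m) (below m)) (subst (_≤ B) (dot-Joins w joins-m′) (below m′))
                (trans (interchange (w a) (w c) (w b) (w d))
                       (cong₂ _+_ (value joins-k (Equivalence.from ∈-⁅⁆∪⁅⁆ (inj₁ refl)))
                                  (value joins-l (Equivalence.from ∈-⁅⁆∪⁅⁆ (inj₂ refl))))))
    m∉ : ¬ (m ≡ k ⊎ m ≡ l)
    m∉ (inj₁ refl) with Joins-unique joins-m joins-k
    ... | inj₁ (_ , c≡b) = b≢c (sym c≡b)
    ... | inj₂ (_ , c≡a) = a≢c (sym c≡a)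
    m∉ (inj₂ refl) with Joins-unique joins-m joins-l
    ... | inj₁ (a≡c , _) = a≢c a≡c
    ... | inj₂ (a≡d , _) = a≢d a≡d

  opposite⇒¬face : ∀ {k l} → Opposite k l → ¬ IsFace (edgeGen G) (⁅ k ⁆ ∪ ⁅ l ⁆)
  opposite⇒¬face {k} {l} (disjoint@(ll , lh , hl , hh) , cross) with Equivalence.to T-∨ cross
  ... | inj₁ straight = let (lo~lo , hi~hi) = Equivalence.to T-∧ straight in
    crossEdges⇒¬face (joins-lo-hi k) (joins-lo-hi l) disjoint (T⇒≡true lo~lo) (T⇒≡true hi~hi)
  ... | inj₂ skew = let (lo~hi , hi~lo) = Equivalence.to T-∧ skew in
    crossEdges⇒¬face (joins-lo-hi k) (joins-hi-lo l) (lh , ll , hh , hl) (T⇒≡true lo~hi) (T⇒≡true hi~lo)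

  isFace-∪-comm : ∀ {k l} → IsFace (edgeGen G) (⁅ l ⁆ ∪ ⁅ k ⁆) → IsFace (edgeGen G) (⁅ k ⁆ ∪ ⁅ l ⁆)
  isFace-∪-comm {k} {l} = subst (IsFace (edgeGen G)) (∪-comm ⁅ l ⁆ ⁅ k ⁆)

  sharedEnd⇒face : ∀ {a b c k l} → k ≢ l → Joins k a b → Joins l a c → IsFace (edgeGen G) (⁅ k ⁆ ∪ ⁅ l ⁆)
  sharedEnd⇒face {b = b} {c} k≢l joins-k joins-l =
    isFace-sharedEnd ((Joins⇒≢ joins-k ∷ Joins⇒≢ joins-l ∷ []) ∷ (b≢c ∷ []) ∷ [] ∷ []) joins-k joins-l
    where
    b≢c : b ≢ c
    b≢c refl = k≢l (Joins-injective joins-k joins-l)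

  lonelyEnd⇒face : ∀ {a b c d k l} → Joins k a b → Joins l c d → Disjoint (a , b) (c , d) →
                   adj G b c ≡ false → adj G b d ≡ false → IsFace (edgeGen G) (⁅ k ⁆ ∪ ⁅ l ⁆)
  lonelyEnd⇒face joins-k joins-l (a≢c , a≢d , b≢c , b≢d) b≁c b≁d =
    isFace-disjoint ((Joins⇒≢ joins-k ∷ a≢c ∷ a≢d ∷ []) ∷ (b≢c ∷ b≢d ∷ []) ∷ (Joins⇒≢ joins-l ∷ []) ∷ [] ∷ [])
                    b≁c b≁d joins-k joins-l

  notCrossed⇒face : ∀ {k l} → Disjoint (ends k) (ends l) → crossed G (ends k) (ends l) ≡ false →
                    IsFace (edgeGen G) (⁅ k ⁆ ∪ ⁅ l ⁆)
  notCrossed⇒face {k} {l} disjoint@(ll , lh , hl , hh) uncrossed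
    with ∨-≡false (adj G (lo k) (lo l) ∧ adj G (hi k) (hi l)) uncrossed
  ... | straight , skew with ∧-≡false (adj G (lo k) (lo l)) straight | ∧-≡false (adj G (lo k) (hi l)) skew
  ... | inj₁ lo≁lo | inj₁ lo≁hi = lonelyEnd⇒face (joins-hi-lo k) (joins-lo-hi l) (hl , hh , ll , lh) lo≁lo lo≁hi
  ... | inj₂ hi≁hi | inj₂ hi≁lo = lonelyEnd⇒face (joins-lo-hi k) (joins-lo-hi l) disjoint hi≁lo hi≁hi
  ... | inj₁ lo≁lo | inj₂ hi≁lo = isFace-∪-comm (lonelyEnd⇒face (joins-hi-lo l) (joins-lo-hi k)
                                    (lh ∘ sym , hh ∘ sym , ll ∘ sym , hl ∘ sym) (≁-sym G lo≁lo) (≁-sym G hi≁lo))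
  ... | inj₂ hi≁hi | inj₁ lo≁hi = isFace-∪-comm (lonelyEnd⇒face (joins-lo-hi l) (joins-lo-hi k)
                                    (ll ∘ sym , hl ∘ sym , lh ∘ sym , hh ∘ sym) (≁-sym G lo≁hi) (≁-sym G hi≁hi))

  ¬opposite⇒face : ∀ {k l} → k ≢ l → ¬ Opposite k l → IsFace (edgeGen G) (⁅ k ⁆ ∪ ⁅ l ⁆)
  ¬opposite⇒face {k} {l} k≢l ¬opposite
    with lo k ≟ lo l | lo k ≟ hi l | hi k ≟ lo l | hi k ≟ hi l
  ... | yes ll | _ | _ | _ = sharedEnd⇒face k≢l (joins-lo-hi k) (inj₁ (sym ll , refl))
  ... | no _ | yes lh | _ | _ = sharedEnd⇒face k≢l (joins-lo-hi k) (inj₂ (refl , sym lh))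
  ... | no _ | no _ | yes hl | _ = sharedEnd⇒face k≢l (joins-hi-lo k) (inj₁ (sym hl , refl))
  ... | no _ | no _ | no _ | yes hh = sharedEnd⇒face k≢l (joins-hi-lo k) (inj₂ (refl , sym hh))
  ... | no ll | no lh | no hl | no hh = notCrossed⇒face disjoint (¬T⇒≡false (¬opposite ∘ (disjoint ,_)))
    where
    disjoint : Disjoint (ends k) (ends l)
    disjoint = ll , lh , hl , hh

module OneFaces {n : ℕ} (G : SimpleGraph n) where

  open import Data.Nat using (_+_; _≤_)
  open import Data.Nat.Properties using (+-comm)
  import Data.Nat.Properties as ℕ
  open import Data.Nat.Combinatorics using (_C_)
  open import Data.Fin.Properties using (any?; <-cmp; <-asym; <⇒≢)
  import Data.Fin.Properties as Fin
  open import Data.Fin.Subset using (∣_∣; _⊆_)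
  open import Data.Fin.Subset.Properties using (x∈⁅x⁆; ∣⁅x⁆∣≡1; ⊆-antisym; p⊆q⇒∣p∣≤∣q∣; _∈?_; ∪-comm)
  open import Data.List.Properties using (length-map)
  open import Data.List.Relation.Unary.Unique.Propositional using (Unique)
  open import Data.List.Relation.Unary.Unique.Propositional.Properties using (filter⁺)
  open import Data.List.Membership.Propositional.Properties using (∈-map⁺; ∈-map⁻; ∈-filter⁺; ∈-filter⁻)
  open import Relation.Binary using (tri<; tri≈; tri>)
  open EdgePairs G
  open SmallAffIndep G using (affIndep-pair; affIndep-triple)
  open AffineIndependence using (affIndep⇒affDim; affDim-tooBig)
  open Lists
  open Subsets
  open IncreasingPairs

  isDFace₁-pair : ∀ {k l} → k ≢ l → ¬ Opposite k l → IsDFace (edgeGen G) 1 (⁅ k ⁆ ∪ ⁅ l ⁆)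
  isDFace₁-pair k≢l ¬opposite = ¬opposite⇒face k≢l ¬opposite , affIndep⇒affDim _ (affIndep-pair k≢l) (∣⁅x⁆∪⁅y⁆∣ k≢l)

  isDFace₁⇒pair : ∀ {S} → IsDFace (edgeGen G) 1 S → ∃[ k ] ∃[ l ] (k ≢ l × S ≡ ⁅ k ⁆ ∪ ⁅ l ⁆)
  isDFace₁⇒pair {S} (_ , dim@((T , T⊆S , _ , size) , _)) with nonempty T size
  ... | k , k∈T with any? (λ l → l ∈? T ×-dec ¬? (l ≟ k))
  ...   | no no-other = ⊥-elim (ℕ.<-irrefl refl (subst (_≤ 1) size (subst (∣ T ∣ ≤_) (∣⁅x⁆∣≡1 k) (p⊆q⇒∣p∣≤∣q∣ T⊆⁅k⁆))))
    where
    T⊆⁅k⁆ : T ⊆ ⁅ k ⁆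
    T⊆⁅k⁆ {l} l∈T with l ≟ k
    ... | yes refl = x∈⁅x⁆ l
    ... | no l≢k = ⊥-elim (no-other (l , l∈T , l≢k))
  ...   | yes (l , l∈T , l≢k) = k , l , k≢l , ⊆-antisym S⊆ (⁅⁆∪⁅⁆⊆ (T⊆S k∈T) (T⊆S l∈T))
    where
    k≢l : k ≢ l
    k≢l = l≢k ∘ sym
    S⊆ : S ⊆ ⁅ k ⁆ ∪ ⁅ l ⁆
    S⊆ {x} x∈S with x ≟ k | x ≟ l
    ... | yes x≡k | _ = Equivalence.from ∈-⁅⁆∪⁅⁆ (inj₁ x≡k)
    ... | no _ | yes x≡l = Equivalence.from ∈-⁅⁆∪⁅⁆ (inj₂ x≡l)
    ... | no x≢k | no x≢l = ⊥-elim (affDim-tooBig _ dim triple⊆S (affIndep-triple k≢l (x≢k ∘ sym) (x≢l ∘ sym))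
                                                   (∣⁅x⁆∪⁅y⁆∪⁅z⁆∣ k≢l (x≢k ∘ sym) (x≢l ∘ sym)))
      where
      triple⊆S : ⁅ k ⁆ ∪ (⁅ l ⁆ ∪ ⁅ x ⁆) ⊆ S
      triple⊆S y∈ with Equivalence.to ∈-⁅⁆∪⁅⁆∪⁅⁆ y∈
      ... | inj₁ refl = T⊆S k∈T
      ... | inj₂ (inj₁ refl) = T⊆S l∈T
      ... | inj₂ (inj₂ refl) = x∈S

  oppositePair? : ∀ (x : Fin (e G) × Fin (e G)) → Dec (Opposite (proj₁ x) (proj₂ x))
  oppositePair? (k , l) = opposite? k l

  oppositePairs nonOppositePairs : List (Fin (e G) × Fin (e G))
  oppositePairs = filter oppositePair? (increasingPairs (e G))
  nonOppositePairs = filter (λ x → ¬? (oppositePair? x)) (increasingPairs (e G))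

  length-nonOpposite+opposite : length nonOppositePairs + length oppositePairs ≡ e G C 2
  length-nonOpposite+opposite = trans (+-comm (length nonOppositePairs) _)
    (trans (length-filter-+-filter-¬ oppositePair? (increasingPairs (e G))) (length-increasingPairs (e G)))

  ∈-oppositePairs⁻ : ∀ {k l} → (k , l) ∈ oppositePairs → k < l × Opposite k l
  ∈-oppositePairs⁻ kl∈ = let (kl∈′ , opposite) = ∈-filter⁻ oppositePair? kl∈ in ∈-increasingPairs⁻ (e G) kl∈′ , opposite

  ∈-oppositePairs⁺ : ∀ {k l} → k < l → Opposite k l → (k , l) ∈ oppositePairs
  ∈-oppositePairs⁺ k<l opposite = ∈-filter⁺ oppositePair? (∈-increasingPairs⁺ (e G) k<l) opposite

  pairSubset : Fin (e G) × Fin (e G) → Subset (e G)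
  pairSubset (k , l) = ⁅ k ⁆ ∪ ⁅ l ⁆

  pairSubset-injective : ∀ {x y} → proj₁ x < proj₂ x → proj₁ y < proj₂ y → pairSubset x ≡ pairSubset y → x ≡ y
  pairSubset-injective {k , l} {k′ , l′} k<l k′<l′ eq
    with Equivalence.to ∈-⁅⁆∪⁅⁆ (subst (k Subset.∈_) eq (Equivalence.from ∈-⁅⁆∪⁅⁆ (inj₁ refl)))
       | Equivalence.to ∈-⁅⁆∪⁅⁆ (subst (l Subset.∈_) eq (Equivalence.from ∈-⁅⁆∪⁅⁆ (inj₂ refl)))
  ... | inj₁ refl | inj₂ refl = refl
  ... | inj₁ refl | inj₁ refl = ⊥-elim (Fin.<-irrefl refl k<l)
  ... | inj₂ refl | inj₂ refl = ⊥-elim (Fin.<-irrefl refl k<l)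
  ... | inj₂ refl | inj₁ refl = ⊥-elim (<-asym k<l k′<l′)

  oneFaces : List (Subset (e G))
  oneFaces = map pairSubset nonOppositePairs

  oneFaces-Unique : Unique oneFaces
  oneFaces-Unique = Unique-map-injectiveOn pairSubset (filter⁺ _ (increasingPairs-Unique (e G))) λ x∈ y∈ →
    pairSubset-injective (increasing x∈) (increasing y∈)
    where
    increasing : ∀ {x} → x ∈ nonOppositePairs → proj₁ x < proj₂ x
    increasing x∈ = ∈-increasingPairs⁻ (e G) (proj₁ (∈-filter⁻ (λ x → ¬? (oppositePair? x)) x∈))

  ∈-oneFaces : ∀ S → S ∈ oneFaces ⇔ IsDFace (edgeGen G) 1 S
  ∈-oneFaces S = mk⇔ to from
    where
    to : S ∈ oneFaces → IsDFace (edgeGen G) 1 S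
    to S∈ with ∈-map⁻ pairSubset S∈
    ... | (k , l) , kl∈ , refl with ∈-filter⁻ (λ x → ¬? (oppositePair? x)) kl∈
    ... | kl∈′ , ¬opposite = isDFace₁-pair (<⇒≢ (∈-increasingPairs⁻ (e G) kl∈′)) ¬opposite
    from : IsDFace (edgeGen G) 1 S → S ∈ oneFaces
    from face@(isFace , _) with isDFace₁⇒pair face
    ... | k , l , k≢l , refl with <-cmp k l
    ... | tri< k<l _ _ = ∈-map⁺ pairSubset (∈-filter⁺ (λ x → ¬? (oppositePair? x)) (∈-increasingPairs⁺ (e G) k<l)
                                                     (λ opposite → opposite⇒¬face opposite isFace))
    ... | tri≈ _ k≡l _ = ⊥-elim (k≢l k≡l)
    ... | tri> _ _ l<k = subst (_∈ oneFaces) (∪-comm ⁅ l ⁆ ⁅ k ⁆)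
            (∈-map⁺ pairSubset (∈-filter⁺ (λ x → ¬? (oppositePair? x)) (∈-increasingPairs⁺ (e G) l<k)
                                           (λ opposite → opposite⇒¬face opposite (isFace-∪-comm isFace))))

  faceNumber₁ : FaceNumber (edgeGen G) 1 (length nonOppositePairs)
  faceNumber₁ = oneFaces , length-map pairSubset nonOppositePairs , oneFaces-Unique , ∈-oneFaces

module Quads where

  open import Data.Nat using (_+_; _*_)
  import Data.Nat.Properties as ℕ
  open import Data.List using ([_])
  open import Data.List.Relation.Unary.Unique.Propositional using (Unique)
  open import Data.List.Relation.Unary.Unique.Propositional.Properties using (allFin⁺)
  open import Data.List.Membership.Propositional.Properties using (∈-allFin)
  open import Data.Fin.Properties using (<-trans; <⇒≢)
  open Lists
  open FinOrder
  open Booleans using (∀-Bool?)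
  open VertexPairs using (Disjoint)

  Quad : ℕ → Set
  Quad n = Fin n × Fin n × Fin n × Fin n

  Increasing : ∀ {n} → Quad n → Set
  Increasing (a , b , c , d) = a < b × b < c × c < d

  matching : ∀ {n} → Quad n → Fin 3 → (Fin n × Fin n) × (Fin n × Fin n)
  matching (a , b , c , d) zero = (a , b) , (c , d)
  matching (a , b , c , d) (suc zero) = (a , c) , (b , d)
  matching (a , b , c , d) (suc (suc zero)) = (a , d) , (b , c)

  matching-increasing : ∀ {n} {q : Quad n} → Increasing q →
                        ∀ x → proj₁ (proj₁ (matching q x)) < proj₂ (proj₁ (matching q x))
                            × proj₁ (proj₂ (matching q x)) < proj₂ (proj₂ (matching q x))
  matching-increasing {q = _ , _ , _ , _} (a<b , b<c , c<d) zero = a<b , c<d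
  matching-increasing {q = _ , _ , _ , _} (a<b , b<c , c<d) (suc zero) = <-trans a<b b<c , <-trans b<c c<d
  matching-increasing {q = _ , _ , _ , _} (a<b , b<c , c<d) (suc (suc zero)) = <-trans a<b (<-trans b<c c<d) , b<c

  matching-disjoint : ∀ {n} {q : Quad n} → Increasing q → ∀ x → Disjoint (proj₁ (matching q x)) (proj₂ (matching q x))
  matching-disjoint {q = _ , _ , _ , _} (a<b , b<c , c<d) zero =
    <⇒≢ (<-trans a<b b<c) , <⇒≢ (<-trans a<b (<-trans b<c c<d)) , <⇒≢ b<c , <⇒≢ (<-trans b<c c<d)
  matching-disjoint {q = _ , _ , _ , _} (a<b , b<c , c<d) (suc zero) =
    <⇒≢ a<b , <⇒≢ (<-trans a<b (<-trans b<c c<d)) , <⇒≢ b<c ∘ sym , <⇒≢ c<d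
  matching-disjoint {q = _ , _ , _ , _} (a<b , b<c , c<d) (suc (suc zero)) =
    <⇒≢ a<b , <⇒≢ (<-trans a<b b<c) , <⇒≢ (<-trans b<c c<d) ∘ sym , <⇒≢ c<d ∘ sym

  module QuadList (n : ℕ) where

    increasingᵇ : Quad n → Bool
    increasingᵇ (a , b , c , d) = (a <ᶠ b) ∧ (b <ᶠ c) ∧ (c <ᶠ d)

    -- the levels of the nested enumeration defining quads n
    from₃ : Fin n → Fin n → Fin n → List (Quad n)
    from₃ a b c = concatMap (λ d → if increasingᵇ (a , b , c , d) then [ (a , b , c , d) ] else []) (allFin n)

    from₂ : Fin n → Fin n → List (Quad n)
    from₂ a b = concatMap (from₃ a b) (allFin n)

    from₁ : Fin n → List (Quad n)
    from₁ a = concatMap (from₂ a) (allFin n)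

    ∈-from₃ : ∀ {a b c q} → q ∈ from₃ a b c → ∃[ d ] (q ≡ (a , b , c , d) × T (increasingᵇ q))
    ∈-from₃ {a} {b} {c} q∈ with ∈-concatMap⁻′ _ (allFin n) q∈
    ... | d , _ , q∈′ with ∈-guarded⁻ (increasingᵇ (a , b , c , d)) q∈′
    ...   | refl , incr = d , refl , incr

    ∈-from₂ : ∀ {a b q} → q ∈ from₂ a b → ∃[ c ] ∃[ d ] (q ≡ (a , b , c , d) × T (increasingᵇ q))
    ∈-from₂ {a} {b} q∈ with ∈-concatMap⁻′ (from₃ a b) (allFin n) q∈
    ... | c , _ , q∈′ = c , ∈-from₃ q∈′

    ∈-from₁ : ∀ {a q} → q ∈ from₁ a → ∃[ b ] ∃[ c ] ∃[ d ] (q ≡ (a , b , c , d) × T (increasingᵇ q))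
    ∈-from₁ {a} q∈ with ∈-concatMap⁻′ (from₂ a) (allFin n) q∈
    ... | b , _ , q∈′ = b , ∈-from₂ q∈′

    ∈-quads⁻ : ∀ {q} → q ∈ quads n → Increasing q
    ∈-quads⁻ q∈ with ∈-concatMap⁻′ from₁ (allFin n) q∈
    ... | a , _ , q∈′ with ∈-from₁ q∈′
    ...   | b , c , d , refl , incr =
      let (a<b , rest) = Equivalence.to T-∧ incr ; (b<c , c<d) = Equivalence.to T-∧ rest in
      <ᶠ⇒< a<b , <ᶠ⇒< b<c , <ᶠ⇒< c<d

    ∈-quads⁺ : ∀ {q} → Increasing q → q ∈ quads n
    ∈-quads⁺ {a , b , c , d} (a<b , b<c , c<d) =
      ∈-concatMap⁺′ from₁ (∈-allFin a) (∈-concatMap⁺′ (from₂ a) (∈-allFin b) (∈-concatMap⁺′ (from₃ a b) (∈-allFin c)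
        (∈-concatMap⁺′ _ (∈-allFin d) (∈-guarded⁺ increasing))))
      where
      increasing : T (increasingᵇ (a , b , c , d))
      increasing = Equivalence.from T-∧ (<⇒<ᶠ a<b , Equivalence.from T-∧ (<⇒<ᶠ b<c , <⇒<ᶠ c<d))

    from₃-Unique : ∀ a b c → Unique (from₃ a b c)
    from₃-Unique a b c = Unique-concatMap _ (proj₂ ∘ proj₂ ∘ proj₂)
      (λ d q q∈ → cong (proj₂ ∘ proj₂ ∘ proj₂) (proj₁ (∈-guarded⁻ (increasingᵇ (a , b , c , d)) q∈)))
      (λ d → guarded-Unique (increasingᵇ (a , b , c , d))) (allFin⁺ n)

    from₂-Unique : ∀ a b → Unique (from₂ a b)
    from₂-Unique a b = Unique-concatMap (from₃ a b) (proj₁ ∘ proj₂ ∘ proj₂)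
      (λ c q q∈ → let (_ , q≡ , _) = ∈-from₃ q∈ in cong (proj₁ ∘ proj₂ ∘ proj₂) q≡) (from₃-Unique a b) (allFin⁺ n)

    from₁-Unique : ∀ a → Unique (from₁ a)
    from₁-Unique a = Unique-concatMap (from₂ a) (proj₁ ∘ proj₂)
      (λ b q q∈ → let (_ , _ , q≡ , _) = ∈-from₂ q∈ in cong (proj₁ ∘ proj₂) q≡) (from₂-Unique a) (allFin⁺ n)

    quads-Unique : Unique (quads n)
    quads-Unique = Unique-concatMap from₁ proj₁
      (λ a q q∈ → let (_ , _ , _ , q≡ , _) = ∈-from₁ q∈ in cong proj₁ q≡) from₁-Unique (allFin⁺ n)

  -- Given the adjacencies among a, b, c, d: both edges of the matching are present, and so are both edges of
  -- another matching, which together form a 4-cycle.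
  oppositeMatchingᵇ : (ab ac ad bc bd cd : Bool) → Fin 3 → Bool
  oppositeMatchingᵇ ab ac ad bc bd cd zero = ab ∧ cd ∧ ((ac ∧ bd) ∨ (ad ∧ bc))
  oppositeMatchingᵇ ab ac ad bc bd cd (suc zero) = ac ∧ bd ∧ ((ab ∧ cd) ∨ (ad ∧ bc))
  oppositeMatchingᵇ ab ac ad bc bd cd (suc (suc zero)) = ad ∧ bc ∧ ((ab ∧ cd) ∨ (ac ∧ bd))

  -- A 4-cycle on {a, b, c, d} is the union of two present matchings, both counted on the left; in K₄ the
  -- three 4-cycles share the three matchings, whence the correction 3 [K₄].
  quadCount : ∀ ab ac ad bc bd cd →
    length (filter (λ x → T? (oppositeMatchingᵇ ab ac ad bc bd cd x)) (allFin 3)) + 3 * b2n (ab ∧ ac ∧ ad ∧ bc ∧ bd ∧ cd)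
    ≡ 2 * (b2n (ab ∧ bc ∧ cd ∧ ad) + b2n (ab ∧ bd ∧ cd ∧ ac) + b2n (ac ∧ bc ∧ bd ∧ ad))
  quadCount =
    toWitness {a? = ∀-Bool? λ ab → ∀-Bool? λ ac → ∀-Bool? λ ad → ∀-Bool? λ bc → ∀-Bool? λ bd → ∀-Bool? λ cd → _ ℕ.≟ _} _

module QuadCount {n : ℕ} (G : SimpleGraph n) where

  open import Data.Nat using (_+_; _*_)
  open import Data.List.Properties using (length-map)
  open import Data.List.Relation.Unary.Unique.Propositional using (Unique)
  open import Data.List.Relation.Unary.Unique.Propositional.Properties using (map⁺; filter⁺; allFin⁺)
  open import Data.List.Membership.Propositional.Properties using (∈-map⁺; ∈-map⁻; ∈-filter⁺; ∈-filter⁻; ∈-allFin)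
  open Lists
  open Quads
  open QuadList n
  open VertexPairs using (crossed)

  oppositeMatching : Quad n → Fin 3 → Bool
  oppositeMatching (a , b , c , d) =
    oppositeMatchingᵇ (adj G a b) (adj G a c) (adj G a d) (adj G b c) (adj G b d) (adj G c d)

  oppositeMatching≡ : ∀ q x → let ((i , j) , (i′ , j′)) = matching q x in
                      oppositeMatching q x ≡ adj G i j ∧ adj G i′ j′ ∧ crossed G (i , j) (i′ , j′)
  oppositeMatching≡ (a , b , c , d) zero = refl
  oppositeMatching≡ (a , b , c , d) (suc zero) rewrite SimpleGraph.sym G c b = refl
  oppositeMatching≡ (a , b , c , d) (suc (suc zero)) rewrite SimpleGraph.sym G d c | SimpleGraph.sym G d b = refl

  oppositeMatchingsAt : Quad n → List (Quad n × Fin 3)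
  oppositeMatchingsAt q = map (q ,_) (filter (λ x → T? (oppositeMatching q x)) (allFin 3))

  oppositeMatchings : List (Quad n × Fin 3)
  oppositeMatchings = concatMap oppositeMatchingsAt (quads n)

  c4At : Quad n → ℕ
  c4At (a , b , c , d) = b2n (cyc G a b c d) + b2n (cyc G a b d c) + b2n (cyc G a c b d)

  isK4 : Quad n → Bool
  isK4 (a , b , c , d) = adj G a b ∧ adj G a c ∧ adj G a d ∧ adj G b c ∧ adj G b d ∧ adj G c d

  ∈-oppositeMatchings⁺ : ∀ {q x} → Increasing q → T (oppositeMatching q x) → (q , x) ∈ oppositeMatchings
  ∈-oppositeMatchings⁺ {q} {x} incr opposite =
    ∈-concatMap⁺′ oppositeMatchingsAt (∈-quads⁺ incr)
      (∈-map⁺ (q ,_) (∈-filter⁺ (λ x → T? (oppositeMatching q x)) (∈-allFin x) opposite))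

  ∈-oppositeMatchings⁻ : ∀ {q x} → (q , x) ∈ oppositeMatchings → Increasing q × T (oppositeMatching q x)
  ∈-oppositeMatchings⁻ y∈ with ∈-concatMap⁻′ oppositeMatchingsAt (quads n) y∈
  ... | q , q∈ , y∈′ with ∈-map⁻ (q ,_) {xs = filter (λ x → T? (oppositeMatching q x)) (allFin 3)} y∈′
  ...   | x , x∈ , refl = ∈-quads⁻ q∈ , proj₂ (∈-filter⁻ (λ x → T? (oppositeMatching q x)) {xs = allFin 3} x∈)

  oppositeMatchings-Unique : Unique oppositeMatchings
  oppositeMatchings-Unique = Unique-concatMap oppositeMatchingsAt proj₁ key at-Unique quads-Unique
    where
    key : ∀ q y → y ∈ oppositeMatchingsAt q → proj₁ y ≡ q
    key q y y∈ with ∈-map⁻ (q ,_) {xs = filter (λ x → T? (oppositeMatching q x)) (allFin 3)} y∈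
    ... | _ , _ , refl = refl
    at-Unique : ∀ q → Unique (oppositeMatchingsAt q)
    at-Unique q = map⁺ (cong proj₂) (filter⁺ (λ x → T? (oppositeMatching q x)) (allFin⁺ 3))

  length-oppositeMatchingsAt : ∀ q → length (oppositeMatchingsAt q) + 3 * b2n (isK4 q) ≡ 2 * c4At q
  length-oppositeMatchingsAt q@(a , b , c , d)
    rewrite length-map (q ,_) (filter (λ x → T? (oppositeMatching q x)) (allFin 3))
          | SimpleGraph.sym G c b | SimpleGraph.sym G d c | SimpleGraph.sym G d a | SimpleGraph.sym G c a
    = quadCount (adj G a b) (adj G a c) (adj G a d) (adj G b c) (adj G b d) (adj G c d)

  length-oppositeMatchings : length oppositeMatchings + 3 * k4 G ≡ 2 * c4 G
  length-oppositeMatchings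
    rewrite length-concatMap oppositeMatchingsAt (quads n) | length-filter-T≡sum isK4 (quads n) =
    sumℕ-linear 3 2 (length ∘ oppositeMatchingsAt) (b2n ∘ isK4) c4At (quads n) length-oppositeMatchingsAt

module Decoding (n : ℕ) where

  open import Data.Fin.Properties using (<-trans)
  open FinOrder
  open VertexPairs using (Disjoint)
  open Quads

  Matches : Quad n → Fin 3 → Fin n × Fin n → Fin n × Fin n → Set
  Matches q x e e′ = matching q x ≡ (e , e′) ⊎ matching q x ≡ (e′ , e)

  -- For disjoint increasing pairs ij and i′j′ with i < i′: the increasing quadruple of the four ends, and the
  -- index of the matching {ij, i′j′} in it.
  merge : Fin n → Fin n → Fin n → Fin n → Quad n × Fin 3
  merge i j i′ j′ = if j <ᶠ i′ then ((i , j , i′ , j′) , zero)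
                    else if j <ᶠ j′ then ((i , i′ , j , j′) , suc zero)
                    else ((i , i′ , j′ , j) , suc (suc zero))

  decode : Fin n × Fin n → Fin n × Fin n → Quad n × Fin 3
  decode (i , j) (i′ , j′) = if i <ᶠ i′ then merge i j i′ j′ else merge i′ j′ i j

  merge-sound : ∀ {i j i′ j′} → i < j → i′ < j′ → i < i′ → j ≢ i′ → j ≢ j′ →
                let (q , x) = merge i j i′ j′ in Increasing q × matching q x ≡ ((i , j) , (i′ , j′))
  merge-sound {i} {j} {i′} {j′} i<j i′<j′ i<i′ j≢i′ j≢j′ with j <ᶠ i′ in j?i′ | j <ᶠ j′ in j?j′
  ... | true | _ = (i<j , <ᶠ-≡true⇒< j?i′ , i′<j′) , refl
  ... | false | true = (i<i′ , ≮∧≢⇒> (<ᶠ-≡false⇒≮ j?i′) j≢i′ , <ᶠ-≡true⇒< j?j′) , refl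
  ... | false | false = (i<i′ , i′<j′ , ≮∧≢⇒> (<ᶠ-≡false⇒≮ j?j′) j≢j′) , refl

  decode-sound : ∀ {i j i′ j′} → i < j → i′ < j′ → Disjoint (i , j) (i′ , j′) →
                 let (q , x) = decode (i , j) (i′ , j′) in Increasing q × Matches q x (i , j) (i′ , j′)
  decode-sound {i} {j} {i′} {j′} i<j i′<j′ (i≢i′ , i≢j′ , j≢i′ , j≢j′) with i <ᶠ i′ in i?i′
  ... | true = let (incr , m≡) = merge-sound i<j i′<j′ (<ᶠ-≡true⇒< i?i′) j≢i′ j≢j′ in incr , inj₁ m≡
  ... | false = let (incr , m≡) = merge-sound i′<j′ i<j (≮∧≢⇒> (<ᶠ-≡false⇒≮ i?i′) i≢i′) (i≢j′ ∘ sym) (j≢j′ ∘ sym) in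
                  incr , inj₂ m≡

  decode-complete : ∀ {q x e e′} → Increasing q → Matches q x e e′ → decode e e′ ≡ (q , x)
  decode-complete {a , b , c , d} {zero} (a<b , b<c , c<d) (inj₁ refl)
    rewrite <⇒<ᶠ-≡true (<-trans a<b b<c) | <⇒<ᶠ-≡true b<c = refl
  decode-complete {a , b , c , d} {zero} (a<b , b<c , c<d) (inj₂ refl)
    rewrite <⇒>ᶠ-≡false (<-trans a<b b<c) | <⇒<ᶠ-≡true b<c = refl
  decode-complete {a , b , c , d} {suc zero} (a<b , b<c , c<d) (inj₁ refl)
    rewrite <⇒<ᶠ-≡true a<b | <⇒>ᶠ-≡false b<c | <⇒<ᶠ-≡true c<d = refl
  decode-complete {a , b , c , d} {suc zero} (a<b , b<c , c<d) (inj₂ refl)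
    rewrite <⇒>ᶠ-≡false a<b | <⇒>ᶠ-≡false b<c | <⇒<ᶠ-≡true c<d = refl
  decode-complete {a , b , c , d} {suc (suc zero)} (a<b , b<c , c<d) (inj₁ refl)
    rewrite <⇒<ᶠ-≡true a<b | <⇒>ᶠ-≡false (<-trans b<c c<d) | <⇒>ᶠ-≡false c<d = refl
  decode-complete {a , b , c , d} {suc (suc zero)} (a<b , b<c , c<d) (inj₂ refl)
    rewrite <⇒>ᶠ-≡false a<b | <⇒>ᶠ-≡false (<-trans b<c c<d) | <⇒>ᶠ-≡false c<d = refl

module OppositeCount {n : ℕ} (G : SimpleGraph n) where

  open import Data.Fin.Properties using (<-cmp; <-asym)
  open import Data.List.Properties using (length-map)
  open import Data.List.Relation.Unary.Unique.Propositional.Properties using (filter⁺)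
  open import Data.List.Membership.Propositional.Properties using (∈-map⁺; ∈-map⁻)
  open import Data.Product.Properties using (≡-dec)
  open import Relation.Binary using (tri<; tri≈; tri>)
  open EdgeList G
  open EdgePairs G
  open OneFaces G using (oppositePair?; oppositePairs; ∈-oppositePairs⁻; ∈-oppositePairs⁺)
  open VertexPairs using (crossed; crossed-sym)
  open Lists
  open FinOrder
  open IncreasingPairs
  open Quads
  open QuadCount G
  open Decoding n

  decodeEdges : Fin (e G) × Fin (e G) → Quad n × Fin 3
  decodeEdges (k , l) = decode (ends k) (ends l)

  decodeEdges-sound : ∀ {k l} → Opposite k l →
    let (q , x) = decodeEdges (k , l) in Increasing q × Matches q x (ends k) (ends l)
  decodeEdges-sound {k} {l} (disjoint , _) = decode-sound (<ᶠ⇒< (lo<hi k)) (<ᶠ⇒< (lo<hi l)) disjoint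

  decodeEdges-injective : ∀ {x y} → x ∈ oppositePairs → y ∈ oppositePairs → decodeEdges x ≡ decodeEdges y → x ≡ y
  decodeEdges-injective {k , l} {k′ , l′} x∈ y∈ same
    with ∈-oppositePairs⁻ x∈ | ∈-oppositePairs⁻ y∈
  ... | k<l , opp | k′<l′ , opp′
    with proj₂ (decodeEdges-sound opp)
       | subst (λ (q , x) → Matches q x (ends k′) (ends l′)) (sym same) (proj₂ (decodeEdges-sound opp′))
  ... | inj₁ m≡ | inj₁ m≡′ = let ends≡ = trans (sym m≡) m≡′ in
    cong₂ _,_ (ends-injective (cong proj₁ ends≡)) (ends-injective (cong proj₂ ends≡))
  ... | inj₂ m≡ | inj₂ m≡′ = let ends≡ = trans (sym m≡) m≡′ in
    cong₂ _,_ (ends-injective (cong proj₂ ends≡)) (ends-injective (cong proj₁ ends≡))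
  ... | inj₁ m≡ | inj₂ m≡′ = let ends≡ = trans (sym m≡′) m≡ in
    ⊥-elim (<-asym k<l (subst₂ _<_ (ends-injective (cong proj₂ ends≡)) (ends-injective (cong proj₁ ends≡)) k′<l′))
  ... | inj₂ m≡ | inj₁ m≡′ = let ends≡ = trans (sym m≡′) m≡ in
    ⊥-elim (<-asym k<l (subst₂ _<_ (ends-injective (cong proj₁ ends≡)) (ends-injective (cong proj₂ ends≡)) k′<l′))

  oppositeMatching-ends : ∀ {q x k l} → Matches q x (ends k) (ends l) → T (crossed G (ends k) (ends l)) →
                          T (oppositeMatching q x)
  oppositeMatching-ends {q} {x} {k} {l} (inj₁ m≡) cross
    rewrite oppositeMatching≡ q x | m≡ | adj-lo-hi k | adj-lo-hi l = cross
  oppositeMatching-ends {q} {x} {k} {l} (inj₂ m≡) cross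
    rewrite oppositeMatching≡ q x | m≡ | adj-lo-hi k | adj-lo-hi l | crossed-sym G (ends l) (ends k) = cross

  decodeEdges-∈ : ∀ {y} → y ∈ map decodeEdges oppositePairs → y ∈ oppositeMatchings
  decodeEdges-∈ y∈ with ∈-map⁻ decodeEdges y∈
  ... | (k , l) , kl∈ , refl with decodeEdges-sound (proj₂ (∈-oppositePairs⁻ kl∈))
  ...   | incr , matches = ∈-oppositeMatchings⁺ incr (oppositeMatching-ends matches (proj₂ (proj₂ (∈-oppositePairs⁻ kl∈))))

  matchedEdges : ∀ {q x} → Increasing q → T (oppositeMatching q x) →
                 ∃[ k ] ∃[ l ] (matching q x ≡ (ends k , ends l) × Opposite k l)
  matchedEdges {q} {x} incr opposite
    with matching q x in m≡ | oppositeMatching≡ q x | matching-increasing incr x | matching-disjoint incr x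
  ... | (i , j) , (i′ , j′) | opp≡ | i<j , i′<j′ | disjoint
    with Equivalence.to T-∧ (subst T opp≡ opposite)
  ... | i~j , rest with Equivalence.to T-∧ rest
  ... | i′~j′ , cross
    with edgeIndex (<⇒<ᶠ i<j) (Equivalence.to T-≡ i~j) | edgeIndex (<⇒<ᶠ i′<j′) (Equivalence.to T-≡ i′~j′)
  ... | k , refl | l , refl = k , l , refl , disjoint , cross

  ∈-decodeEdges : ∀ {y} → y ∈ oppositeMatchings → y ∈ map decodeEdges oppositePairs
  ∈-decodeEdges {q , x} y∈ with ∈-oppositeMatchings⁻ y∈
  ... | incr , opposite with matchedEdges incr opposite
  ... | k , l , m≡ , opp with <-cmp k l
  ... | tri< k<l _ _ = subst (_∈ map decodeEdges oppositePairs) (decode-complete incr (inj₁ m≡))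
                             (∈-map⁺ decodeEdges (∈-oppositePairs⁺ k<l opp))
  ... | tri≈ _ refl _ = ⊥-elim (proj₁ (proj₁ opp) refl)
  ... | tri> _ _ l<k = subst (_∈ map decodeEdges oppositePairs) (decode-complete incr (inj₂ m≡))
                             (∈-map⁺ decodeEdges (∈-oppositePairs⁺ l<k (Opposite-sym opp)))

  length-oppositePairs : length oppositePairs ≡ length oppositeMatchings
  length-oppositePairs = trans (sym (length-map decodeEdges oppositePairs))
    (Unique-⇔⇒length-≡ (≡-dec (≡-dec _≟_ (≡-dec _≟_ (≡-dec _≟_ _≟_))) _≟_)
      (Unique-map-injectiveOn decodeEdges (filter⁺ oppositePair? (increasingPairs-Unique (e G))) decodeEdges-injective)
      oppositeMatchings-Unique decodeEdges-∈ ∈-decodeEdges)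

import Data.Nat as ℕ
open import Data.Nat.Combinatorics using (_C_)
open import Data.Integer using (+_; _+_; _-_; _*_)
import Data.Integer.Properties as ℤ
open import Data.Integer.Solver using (module +-*-Solver)

complementCount : ∀ {N B C c k : ℕ} → N ℕ.+ B ≡ C → B ℕ.+ 3 ℕ.* k ≡ 2 ℕ.* c → + N ≡ + C - + 2 * + c + + 3 * + k
complementCount {N} {B} {C} {c} {k} N+B≡C B+3k≡2c = trans (regroup (+ N) (+ B) (+ k))
                                                          (cong₂ (λ x y → x - y + + 3 * + k) C≡ 2c≡)
  where
  open +-*-Solver
  regroup : ∀ n b k → n ≡ (n + b) - (b + + 3 * k) + + 3 * k
  regroup = solve 3 (λ n b k → n := (n :+ b) :- (b :+ con (+ 3) :* k) :+ con (+ 3) :* k) refl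
  C≡ : + N + + B ≡ + C
  C≡ = trans (sym (ℤ.pos-+ N B)) (cong +_ N+B≡C)
  2c≡ : + B + + 3 * + k ≡ + 2 * + c
  2c≡ = trans (cong (λ z → + B + z) (sym (ℤ.pos-* 3 k)))
              (trans (sym (ℤ.pos-+ B (3 ℕ.* k))) (trans (cong +_ B+3k≡2c) (ℤ.pos-* 2 c)))

proposition3p2 : ∀ (n : ℕ) (G : SimpleGraph n) → NoIsolated G →
    FaceNumber (edgeGen G) 0 (e G) ×
    (∃[ N ] (FaceNumber (edgeGen G) 1 N ×
             + N ≡ + (e G C 2) - + 2 * + c4 G + + 3 * + k4 G))
proposition3p2 n G _ =
  faceNumber₀ , length nonOppositePairs , faceNumber₁ ,
  complementCount {c = c4 G} {k4 G} length-nonOpposite+opposite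
    (trans (cong (ℕ._+ 3 ℕ.* k4 G) length-oppositePairs) length-oppositeMatchings)
  where
  open Vertices G using (faceNumber₀)
  open OneFaces G using (nonOppositePairs; faceNumber₁; length-nonOpposite+opposite)
  open QuadCount G using (length-oppositeMatchings)
  open OppositeCount G using (length-oppositePairs)
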